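{- Let $a,b,c,d\in\mathbb{C}$ with $a\notin\{0,-1,-2,\ldots\}$, and assume the parameters are such that all denominators and all terminating hypergeometric series below are well-defined. Then for every $n\ge0$, $$\sum_{k=0}^n\frac{(-n)_k(n+a)_k(1+a-c-d)_k}{k!\,(1+a-c)_k(1+a-d)_k}\;{}_5F_4\!\left(\begin{matrix}\frac{a-b}2,\ \frac{1+a-b}2,\ c,\ d,\ -k\\ \frac a2,\ 1+a-b,\ \frac{1+a}2,\ c+d-a-k\end{matrix}\,\middle|\,1\right)=\frac{(b)_n(c)_n(d)_n}{(a)_n(1+a-c)_n(1+a-d)_n}.$$
   Context: Rising factorial: $(\gamma)_0=1$, $(\gamma)_k=\gamma(\gamma+1)\cdots(\gamma+k-1)$. The hypergeometric series is ${}_pF_q\!\left(\begin{matrix}a_1,\ldots,a_p\\ b_1,\ldots,b_q\end{matrix}\middle| z\right)=\sum_{m\ge0}\frac{(a_1)_m\cdots(a_p)_m}{m!\,(b_1)_m\cdots(b_q)_m}z^m$; when a numerator parameter is $-k$ with $k$ a nonnegative integer the series terminates after the term $m=k$, and it is required that no denominator parameter lies in $\{ -k+1,\ldots,0\}$. -}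

module Defs where

open import Level using (Level; _⊔_) renaming (suc to lsuc)
open import Data.Nat using (ℕ; zero; suc; _<_)
open import Data.List using (List; []; _∷_)
open import Relation.Nullary using (¬_)
open import Algebra.Bundles using (CommutativeRing)

module RingOps {c ℓ : Level} (R : CommutativeRing c ℓ) where
  open CommutativeRing R using (Carrier; _≈_; _+_; _*_; -_; 0#; 1#)

  ι : ℕ → Carrier
  ι zero    = 0#
  ι (suc n) = 1# + ι n

  _−_ : Carrier → Carrier → Carrier
  x − y = x + (- y)

-- A field of characteristic zero.  The inverse is a total function whose
-- value at 0 is unconstrained (and never used: all denominators in the
-- theorem are assumed nonzero).  ℂ is an instance.
record CharZeroField (c ℓ : Level) : Set (lsuc (c ⊔ ℓ)) where
  field
    commRing : CommutativeRing c ℓ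
  open CommutativeRing commRing public using (Carrier; _≈_; _+_; _*_; -_; 0#; 1#)
  open RingOps commRing public
  field
    _⁻¹      : Carrier → Carrier
    inverseʳ : ∀ x → ¬ (x ≈ 0#) → x * (x ⁻¹) ≈ 1#
    charZero : ∀ n → ¬ (ι (suc n) ≈ 0#)

module FieldOps {c ℓ : Level} (K : CharZeroField c ℓ) where
  open CharZeroField K

  _/_ : Carrier → Carrier → Carrier
  x / y = x * (y ⁻¹)

  half : Carrier
  half = ι 2 ⁻¹

  poch : Carrier → ℕ → Carrier
  poch γ zero    = 1#
  poch γ (suc k) = poch γ k * (γ + ι k)

  fact : ℕ → Carrier
  fact k = ι 1 * poch (ι 1) k

  pochs : List Carrier → ℕ → Carrier
  pochs []       m = 1#
  pochs (γ ∷ γs) m = poch γ m * pochs γs m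

  pow : Carrier → ℕ → Carrier
  pow z zero    = 1#
  pow z (suc m) = pow z m * z

  sumTo : ℕ → (ℕ → Carrier) → Carrier
  sumTo zero    f = f zero
  sumTo (suc N) f = sumTo N f + f (suc N)

  -- Terminating hypergeometric series with numerator parameters
  -- (-k) ∷ as and denominator parameters bs:
  --   Σ_{m=0}^{k} (-k)_m (as)_m / (m! (bs)_m) z^m
  -- (the terms with m > k vanish since (-k)_m = 0).
  termHyp : ℕ → List Carrier → List Carrier → Carrier → Carrier
  termHyp k as bs z =
    sumTo k (λ m → ((poch (- ι k) m * pochs as m) / (fact m * pochs bs m)) * pow z m)

  NotNegIntBelow : ℕ → Carrier → Set ℓ
  NotNegIntBelow k γ = ∀ j → j < k → ¬ (γ + ι j ≈ 0#)

module Submission where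

-- Expand the inner 5F4 and interchange the two sums.  For fixed m, the terms with k = m + j form a
-- balanced terminating 3F2 in j, which the Pfaff–Saalschütz theorem sums; what is left is
--   (c)_n (d)_n / ((1+a-c)_n (1+a-d)_n) · Σ_m (-n)_m (n+a)_m ((a-b)/2)_m ((1+a-b)/2)_m / (m! (a/2)_m (1+a-b)_m ((1+a)/2)_m).
-- This 4F3 equals (b)_n / (a)_n: creative telescoping gives it a three-term recurrence in n, which
-- (b)_n / (a)_n also satisfies, and the two agree for n = 0, 1.  Every field identity is reduced,
-- after clearing denominators, to a polynomial identity checked by the ring solver over ℤ.

open import Defs
open import Level using (Level)
open import Data.Nat as ℕ using (ℕ; zero; suc; _≤_; _<_; _∸_; z≤n; s≤s)
import Data.Nat.Properties as ℕP
open import Data.Integer as ℤ using (ℤ; +_; -[1+_])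
import Data.Integer.Properties as ℤP
open import Data.Maybe using (Maybe; just; nothing)
open import Data.Product using (_×_; proj₁; proj₂)
open import Data.List using ([]; _∷_)
open import Data.Sum using (inj₁; inj₂)
open import Relation.Nullary using (¬_; yes; no)
import Relation.Binary.PropositionalEquality as ≡
open import Algebra.Bundles using (CommutativeRing)
import Algebra.Solver.Ring.AlmostCommutativeRing as ACR
import Algebra.Solver.Ring

module IntegerCoefficients {c′ ℓ : Level} (R : CommutativeRing c′ ℓ) where
  open CommutativeRing R
  open RingOps R
  open import Algebra.Properties.Ring ring using (-‿distribˡ-*; -0#≈0#; -‿involutive)
  open import Algebra.Properties.AbelianGroup +-abelianGroup using (⁻¹-∙-comm)
  open import Relation.Binary.Reasoning.Setoid setoid

  ι-+ : ∀ m n → ι (m ℕ.+ n) ≈ ι m + ι n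
  ι-+ zero    n = sym (+-identityˡ _)
  ι-+ (suc m) n = trans (+-cong refl (ι-+ m n)) (sym (+-assoc _ _ _))

  ι-* : ∀ m n → ι (m ℕ.* n) ≈ ι m * ι n
  ι-* zero    n = sym (zeroˡ _)
  ι-* (suc m) n = begin
    ι (n ℕ.+ m ℕ.* n)     ≈⟨ ι-+ n (m ℕ.* n) ⟩
    ι n + ι (m ℕ.* n)     ≈⟨ +-cong (sym (*-identityˡ _)) (ι-* m n) ⟩
    1# * ι n + ι m * ι n  ≈⟨ sym (distribʳ _ _ _) ⟩
    (1# + ι m) * ι n      ∎

  fromℤ : ℤ → Carrier
  fromℤ (+ n)    = ι n
  fromℤ -[1+ n ] = - ι (suc n)

  ι-suc-− : ∀ m n → ι (suc m) − ι (suc n) ≈ ι m − ι n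
  ι-suc-− m n = begin
    (1# + ι m) + - (1# + ι n)   ≈⟨ +-cong refl (sym (⁻¹-∙-comm 1# (ι n))) ⟩
    (1# + ι m) + (- 1# + - ι n) ≈⟨ +-cong (+-comm _ _) refl ⟩
    (ι m + 1#) + (- 1# + - ι n) ≈⟨ +-assoc _ _ _ ⟩
    ι m + (1# + (- 1# + - ι n)) ≈⟨ +-cong refl (sym (+-assoc _ _ _)) ⟩
    ι m + ((1# + - 1#) + - ι n) ≈⟨ +-cong refl (+-cong (-‿inverseʳ 1#) refl) ⟩
    ι m + (0# + - ι n)          ≈⟨ +-cong refl (+-identityˡ _) ⟩
    ι m − ι n                   ∎

  fromℤ-⊖ : ∀ m n → fromℤ (m ℤ.⊖ n) ≈ ι m − ι n
  fromℤ-⊖ m       zero    = begin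
    fromℤ (m ℤ.⊖ 0)  ≡⟨ ≡.cong fromℤ (ℤP.⊖-≥ {m} {0} ℕ.z≤n) ⟩
    ι m              ≈⟨ sym (+-identityʳ _) ⟩
    ι m + 0#         ≈⟨ +-cong refl (sym -0#≈0#) ⟩
    ι m − ι 0        ∎
  fromℤ-⊖ zero    (suc n) = sym (+-identityˡ _)
  fromℤ-⊖ (suc m) (suc n) = begin
    fromℤ (suc m ℤ.⊖ suc n)  ≡⟨ ≡.cong fromℤ (ℤP.[1+m]⊖[1+n]≡m⊖n m n) ⟩
    fromℤ (m ℤ.⊖ n)          ≈⟨ fromℤ-⊖ m n ⟩
    ι m − ι n                ≈⟨ sym (ι-suc-− m n) ⟩
    ι (suc m) − ι (suc n)    ∎

  fromℤ-+ : ∀ i j → fromℤ (i ℤ.+ j) ≈ fromℤ i + fromℤ j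
  fromℤ-+ -[1+ m ] -[1+ n ] = begin
    - (1# + ι (suc (m ℕ.+ n)))  ≈⟨ -‿cong (+-cong refl (ι-+ (suc m) n)) ⟩
    - (1# + (ι (suc m) + ι n))  ≈⟨ -‿cong (trans (sym (+-assoc _ _ _)) (trans (+-cong (+-comm _ _) refl) (+-assoc _ _ _))) ⟩
    - (ι (suc m) + ι (suc n))   ≈⟨ sym (⁻¹-∙-comm _ _) ⟩
    - ι (suc m) + - ι (suc n)   ∎
  fromℤ-+ -[1+ m ] (+ n)    = trans (fromℤ-⊖ n (suc m)) (+-comm _ _)
  fromℤ-+ (+ m)    -[1+ n ] = fromℤ-⊖ m (suc n)
  fromℤ-+ (+ m)    (+ n)    = ι-+ m n

  fromℤ-neg : ∀ i → fromℤ (ℤ.- i) ≈ - fromℤ i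
  fromℤ-neg -[1+ n ]    = sym (-‿involutive _)
  fromℤ-neg (+ zero)    = sym -0#≈0#
  fromℤ-neg (+ suc n)   = refl

  fromℤ-*ℕ : ∀ m j → fromℤ (+ m ℤ.* j) ≈ ι m * fromℤ j
  fromℤ-*ℕ zero    j = sym (zeroˡ _)
  fromℤ-*ℕ (suc m) j = begin
    fromℤ (+ suc m ℤ.* j)        ≡⟨ ≡.cong fromℤ (ℤP.suc-* (+ m) j) ⟩
    fromℤ (j ℤ.+ + m ℤ.* j)      ≈⟨ fromℤ-+ j (+ m ℤ.* j) ⟩
    fromℤ j + fromℤ (+ m ℤ.* j)  ≈⟨ +-cong (sym (*-identityˡ _)) (fromℤ-*ℕ m j) ⟩
    1# * fromℤ j + ι m * fromℤ j ≈⟨ sym (distribʳ _ _ _) ⟩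
    ι (suc m) * fromℤ j          ∎

  fromℤ-* : ∀ i j → fromℤ (i ℤ.* j) ≈ fromℤ i * fromℤ j
  fromℤ-* (+ m)    j = fromℤ-*ℕ m j
  fromℤ-* -[1+ m ] j = begin
    fromℤ (-[1+ m ] ℤ.* j)        ≡⟨ ≡.cong fromℤ (≡.sym (ℤP.neg-distribˡ-* (+ suc m) j)) ⟩
    fromℤ (ℤ.- (+ suc m ℤ.* j))   ≈⟨ fromℤ-neg (+ suc m ℤ.* j) ⟩
    - fromℤ (+ suc m ℤ.* j)       ≈⟨ -‿cong (fromℤ-*ℕ (suc m) j) ⟩
    - (ι (suc m) * fromℤ j)       ≈⟨ -‿distribˡ-* _ _ ⟩
    - ι (suc m) * fromℤ j         ∎

  fromℤ-morphism : ℤ.+-*-rawRing ACR.-Raw-AlmostCommutative⟶ ACR.fromCommutativeRing R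
  fromℤ-morphism = record
    { ⟦_⟧ = fromℤ ; +-homo = fromℤ-+ ; *-homo = fromℤ-* ; -‿homo = fromℤ-neg
    ; 0-homo = refl ; 1-homo = +-identityʳ 1# }

  fromℤ-≟ : ∀ i j → Maybe (fromℤ i ≈ fromℤ j)
  fromℤ-≟ i j with i ℤ.≟ j
  ... | yes ≡.refl = just refl
  ... | no _       = nothing

  open Algebra.Solver.Ring ℤ.+-*-rawRing (ACR.fromCommutativeRing R) fromℤ-morphism fromℤ-≟ public
    using (Polynomial; solve; _:=_; _:+_; _:*_; _:-_; :-_; con)

  infix 10 #_
  #_ : ∀ {n} → ℕ → Polynomial n
  # k = con (+ k)

module FieldArithmetic {c′ ℓ : Level} (K : CharZeroField c′ ℓ) where
  open CharZeroField K public
  open FieldOps K public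
  open CommutativeRing commRing public
    using ( _≉_; setoid; refl; sym; trans; reflexive; +-cong; *-cong; -‿cong; +-comm; *-comm; +-assoc; *-assoc
          ; distribˡ; zeroˡ; zeroʳ; +-identityˡ; +-identityʳ; *-identityˡ; *-identityʳ; -‿inverseʳ; -‿inverseˡ; ring)
  open import Algebra.Properties.Ring ring public using (-0#≈0#; -‿involutive)
  open IntegerCoefficients commRing public
  open import Relation.Binary.Reasoning.Setoid setoid public

  ≉0-resp : ∀ {x y} → x ≈ y → x ≉ 0# → y ≉ 0#
  ≉0-resp x≈y x≉0 y≈0 = x≉0 (trans x≈y y≈0)

  *-≉0 : ∀ {x y} → x ≉ 0# → y ≉ 0# → x * y ≉ 0#
  *-≉0 {x} {y} x≉0 y≉0 xy≈0 = y≉0 (begin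
    y                  ≈⟨ sym (*-identityˡ y) ⟩
    1# * y             ≈⟨ *-cong (trans (sym (inverseʳ x x≉0)) (*-comm _ _)) refl ⟩
    ((x ⁻¹) * x) * y   ≈⟨ *-assoc _ _ _ ⟩
    (x ⁻¹) * (x * y)   ≈⟨ *-cong refl xy≈0 ⟩
    (x ⁻¹) * 0#        ≈⟨ zeroʳ _ ⟩
    0#                 ∎)

  -‿≉0 : ∀ {x} → x ≉ 0# → - x ≉ 0#
  -‿≉0 {x} x≉0 -x≈0 = x≉0 (trans (sym (-‿involutive x)) (trans (-‿cong -x≈0) -0#≈0#))

  1≉0 : 1# ≉ 0#
  1≉0 = ≉0-resp (+-identityʳ 1#) (charZero 0)

  1+ι≉0 : ∀ j → ι 1 + ι j ≉ 0#
  1+ι≉0 j = ≉0-resp (ι-+ 1 j) (charZero j)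

  /-*-cancel : ∀ {y} x → y ≉ 0# → (x / y) * y ≈ x
  /-*-cancel {y} x y≉0 = begin
    (x * (y ⁻¹)) * y  ≈⟨ *-assoc _ _ _ ⟩
    x * ((y ⁻¹) * y)  ≈⟨ *-cong refl (trans (*-comm _ _) (inverseʳ y y≉0)) ⟩
    x * 1#            ≈⟨ *-identityʳ x ⟩
    x                 ∎

  *-/-cancel : ∀ {y} x → y ≉ 0# → (x * y) / y ≈ x
  *-/-cancel {y} x y≉0 = begin
    (x * y) * (y ⁻¹)  ≈⟨ *-assoc _ _ _ ⟩
    x * (y * (y ⁻¹))  ≈⟨ *-cong refl (inverseʳ y y≉0) ⟩
    x * 1#            ≈⟨ *-identityʳ x ⟩
    x                 ∎

  *-cancelʳ : ∀ {y u v} → y ≉ 0# → u * y ≈ v * y → u ≈ v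
  *-cancelʳ {y} {u} {v} y≉0 uy≈vy = begin
    u                ≈⟨ sym (*-/-cancel u y≉0) ⟩
    (u * y) / y      ≈⟨ *-cong uy≈vy refl ⟩
    (v * y) / y      ≈⟨ *-/-cancel v y≉0 ⟩
    v                ∎

  x*y≈z⇒x≈z/y : ∀ {x y z} → y ≉ 0# → x * y ≈ z → x ≈ z / y
  x*y≈z⇒x≈z/y {z = z} y≉0 xy≈z = *-cancelʳ y≉0 (trans xy≈z (sym (/-*-cancel z y≉0)))

  /-≈-self : ∀ {x y} → y ≉ 0# → x ≈ y → x / y ≈ 1#
  /-≈-self {y = y} y≉0 x≈y = trans (*-cong x≈y refl) (inverseʳ y y≉0)

  1≈ι1 : 1# ≈ ι 1
  1≈ι1 = sym (+-identityʳ 1#)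

  x≈y⇒x−y≈0 : ∀ {x y} → x ≈ y → x − y ≈ 0#
  x≈y⇒x−y≈0 {y = y} x≈y = trans (+-cong x≈y refl) (-‿inverseʳ y)

  x−y≈0⇒x≈y : ∀ {x y} → x − y ≈ 0# → x ≈ y
  x−y≈0⇒x≈y {x} {y} x−y≈0 = begin
    x                ≈⟨ solve 2 (λ x y → x := (x :- y) :+ y) refl x y ⟩
    (x − y) + y      ≈⟨ +-cong x−y≈0 refl ⟩
    0# + y           ≈⟨ +-identityˡ y ⟩
    y                ∎

  x+y*z≈x : ∀ {x y} z → y ≈ 0# → x + y * z ≈ x
  x+y*z≈x {x} z y≈0 = trans (+-cong refl (trans (*-cong y≈0 refl) (zeroˡ z))) (+-identityʳ x)

  x+[u−v]*y≈x : ∀ {x u v} y → u ≈ v → x + (u − v) * y ≈ x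
  x+[u−v]*y≈x y u≈v = x+y*z≈x y (x≈y⇒x−y≈0 u≈v)

  /-*-/ : ∀ {x y z w} → y ≉ 0# → w ≉ 0# → (x / y) * (z / w) ≈ (x * z) / (y * w)
  /-*-/ {x} {y} {z} {w} y≉0 w≉0 = x*y≈z⇒x≈z/y (*-≉0 y≉0 w≉0) (begin
    ((x / y) * (z / w)) * (y * w)    ≈⟨ solve 4 (λ u v y w → (u :* v) :* (y :* w) := (u :* y) :* (v :* w)) refl (x / y) (z / w) y w ⟩
    ((x / y) * y) * ((z / w) * w)    ≈⟨ *-cong (/-*-cancel x y≉0) (/-*-cancel z w≉0) ⟩
    x * z                            ∎)

  /-*ʳ : ∀ x y z → (x / y) * z ≈ (x * z) / y
  /-*ʳ x y z = solve 3 (λ x i z → (x :* i) :* z := (x :* z) :* i) refl x (y ⁻¹) z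

  /-cross : ∀ {x y z w} → y ≉ 0# → w ≉ 0# → x * w ≈ z * y → x / y ≈ z / w
  /-cross {x} {y} {z} {w} y≉0 w≉0 xw≈zy = x*y≈z⇒x≈z/y w≉0 (*-cancelʳ y≉0 (begin
    ((x / y) * w) * y    ≈⟨ solve 3 (λ u w y → (u :* w) :* y := (u :* y) :* w) refl (x / y) w y ⟩
    ((x / y) * y) * w    ≈⟨ *-cong (/-*-cancel x y≉0) refl ⟩
    x * w                ≈⟨ xw≈zy ⟩
    z * y                ∎))

  pow-1# : ∀ m → pow 1# m ≈ 1#
  pow-1# zero    = refl
  pow-1# (suc m) = trans (*-identityʳ _) (pow-1# m)

  x*half+x*half≈x : ∀ x → x * half + x * half ≈ x
  x*half+x*half≈x x = begin
    x * half + x * half  ≈⟨ solve 2 (λ x h → x :* h :+ x :* h := x :* (# 2 :* h)) refl x half ⟩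
    x * (ι 2 * half)     ≈⟨ *-cong refl (inverseʳ (ι 2) (charZero 1)) ⟩
    x * 1#               ≈⟨ *-identityʳ x ⟩
    x                    ∎

  *half+ι≉0 : ∀ x j → x + ι (j ℕ.+ j) ≉ 0# → x * half + ι j ≉ 0#
  *half+ι≉0 x j x+2j≉0 x/2+j≈0 = x+2j≉0 (begin
    x + ι (j ℕ.+ j)                            ≈⟨ +-cong (sym (x*half+x*half≈x x)) (ι-+ j j) ⟩
    (x * half + x * half) + (ι j + ι j)        ≈⟨ solve 2 (λ h j → (h :+ h) :+ (j :+ j) := (h :+ j) :+ (h :+ j)) refl (x * half) (ι j) ⟩
    (x * half + ι j) + (x * half + ι j)        ≈⟨ +-cong x/2+j≈0 x/2+j≈0 ⟩
    0# + 0#                                    ≈⟨ +-identityʳ 0# ⟩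
    0#                                         ∎)

  /-ratio : ∀ {x x′ y y′ p q} → x′ ≈ x * p → y′ ≈ y * q → y ≉ 0# → q ≉ 0# →
            (x′ / y′) * q ≈ (x / y) * p
  /-ratio {x} {x′} {y} {y′} {p} {q} x′≈xp y′≈yq y≉0 q≉0 = *-cancelʳ y′≉0 (begin
    ((x′ / y′) * q) * y′   ≈⟨ solve 3 (λ u q y → (u :* q) :* y := (u :* y) :* q) refl (x′ / y′) q y′ ⟩
    ((x′ / y′) * y′) * q   ≈⟨ *-cong (/-*-cancel x′ y′≉0) refl ⟩
    x′ * q                 ≈⟨ *-cong x′≈xp refl ⟩
    (x * p) * q            ≈⟨ *-cong (*-cong (sym (/-*-cancel x y≉0)) refl) refl ⟩
    (((x / y) * y) * p) * q  ≈⟨ solve 4 (λ u y p q → ((u :* y) :* p) :* q := (u :* p) :* (y :* q)) refl (x / y) y p q ⟩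
    ((x / y) * p) * (y * q)  ≈⟨ *-cong refl (sym y′≈yq) ⟩
    ((x / y) * p) * y′     ∎)
    where
    y′≉0 : y′ ≉ 0#
    y′≉0 = ≉0-resp (sym y′≈yq) (*-≉0 y≉0 q≉0)

module Pochhammer {c′ ℓ : Level} (K : CharZeroField c′ ℓ) where
  open FieldArithmetic K

  poch-cong : ∀ {x y} k → x ≈ y → poch x k ≈ poch y k
  poch-cong zero    x≈y = refl
  poch-cong (suc k) x≈y = *-cong (poch-cong k x≈y) (+-cong x≈y refl)

  poch-+ : ∀ x p q → poch x (p ℕ.+ q) ≈ poch x p * poch (x + ι p) q
  poch-+ x p zero    rewrite ℕP.+-identityʳ p = sym (*-identityʳ _)
  poch-+ x p (suc q) rewrite ℕP.+-suc p q = begin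
    poch x (p ℕ.+ q) * (x + ι (p ℕ.+ q))              ≈⟨ *-cong (poch-+ x p q) (+-cong refl (ι-+ p q)) ⟩
    (poch x p * poch (x + ι p) q) * (x + (ι p + ι q)) ≈⟨ *-assoc _ _ _ ⟩
    poch x p * (poch (x + ι p) q * (x + (ι p + ι q))) ≈⟨ *-cong refl (*-cong refl (sym (+-assoc _ _ _))) ⟩
    poch x p * (poch (x + ι p) q * ((x + ι p) + ι q)) ∎

  poch-1 : ∀ x → poch x 1 ≈ x
  poch-1 x = trans (*-identityˡ _) (+-identityʳ x)

  poch-sucˡ : ∀ x k → poch x (suc k) ≈ x * poch (x + ι 1) k
  poch-sucˡ x k = trans (poch-+ x 1 k) (*-cong (poch-1 x) refl)

  poch-sucˡ′ : ∀ {x y} M → x + ι 1 ≈ y → poch x (suc M) ≈ x * poch y M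
  poch-sucˡ′ M x+1≈y = trans (poch-sucˡ _ M) (*-cong refl (poch-cong M x+1≈y))

  NotNegIntBelow-≤ : ∀ {k n x} → k ≤ n → NotNegIntBelow n x → NotNegIntBelow k x
  NotNegIntBelow-≤ k≤n h j j<k = h j (ℕP.<-≤-trans j<k k≤n)

  NotNegIntBelow-shift : ∀ {x} m N → NotNegIntBelow (m ℕ.+ N) x → NotNegIntBelow N (x + ι m)
  NotNegIntBelow-shift m N h j j<N =
    ≉0-resp (trans (+-cong refl (ι-+ m j)) (sym (+-assoc _ _ _))) (h (m ℕ.+ j) (ℕP.+-monoʳ-< m j<N))

  poch-≉0 : ∀ {x} k → NotNegIntBelow k x → poch x k ≉ 0#
  poch-≉0 zero    h = 1≉0
  poch-≉0 (suc k) h = *-≉0 (poch-≉0 k (NotNegIntBelow-≤ (ℕP.n≤1+n k) h)) (h k ℕP.≤-refl)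

  fact-≉0 : ∀ k → fact k ≉ 0#
  fact-≉0 k = *-≉0 (charZero 0) (poch-≉0 k (λ j _ → 1+ι≉0 j))

  poch-−ι-vanish : ∀ {N m} → N < m → poch (- ι N) m ≈ 0#
  poch-−ι-vanish {N} {suc m} (s≤s N≤m) with ℕP.m≤n⇒m<n∨m≡n N≤m
  ... | inj₁ N<m    = trans (*-cong (poch-−ι-vanish N<m) refl) (zeroˡ _)
  ... | inj₂ ≡.refl = trans (*-cong refl (-‿inverseˡ (ι N))) (zeroʳ _)

  sign : ℕ → Carrier
  sign = pow (- ι 1)

  sign-≉0 : ∀ k → sign k ≉ 0#
  sign-≉0 zero    = 1≉0
  sign-≉0 (suc k) = *-≉0 (sign-≉0 k) (-‿≉0 (charZero 0))

  poch-reflect : ∀ k {x y} → (x + y) + ι k ≈ ι 1 → poch x k ≈ sign k * poch y k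
  poch-reflect zero    _ = sym (*-identityˡ _)
  poch-reflect (suc k) {x} {y} x+y+k+1≈1 = begin
    poch x k * (x + ι k)                          ≈⟨ *-cong (poch-reflect k shifted) last-factor ⟩
    (sign k * poch (y + ι 1) k) * (- ι 1 * y)     ≈⟨ solve 4 (λ s p m y → (s :* p) :* (m :* y) := (s :* m) :* (y :* p))
                                                     refl (sign k) (poch (y + ι 1) k) (- ι 1) y ⟩
    (sign k * - ι 1) * (y * poch (y + ι 1) k)     ≈⟨ *-cong refl (sym (poch-sucˡ y k)) ⟩
    sign (suc k) * poch y (suc k)                 ∎
    where
    shifted : (x + (y + ι 1)) + ι k ≈ ι 1
    shifted = trans (solve 3 (λ x y k → (x :+ (y :+ # 1)) :+ k := (x :+ y) :+ (# 1 :+ k)) refl x y (ι k))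
                    (trans (+-cong refl (sym (ι-+ 1 k))) x+y+k+1≈1)
    last-factor : x + ι k ≈ - ι 1 * y
    last-factor = begin
      x + ι k                                  ≈⟨ solve 3 (λ x y k → x :+ k := ((x :+ y) :+ (# 1 :+ k)) :- (# 1 :+ y)) refl x y (ι k) ⟩
      ((x + y) + (ι 1 + ι k)) − (ι 1 + y)      ≈⟨ +-cong (trans (+-cong refl (sym (ι-+ 1 k))) x+y+k+1≈1) refl ⟩
      ι 1 − (ι 1 + y)                          ≈⟨ solve 1 (λ y → # 1 :- (# 1 :+ y) := :- # 1 :* y) refl y ⟩
      - ι 1 * y                                ∎

module FiniteSums {c′ ℓ : Level} (K : CharZeroField c′ ℓ) where
  open FieldArithmetic K

  sumTo-cong : ∀ N {f g : ℕ → Carrier} → (∀ m → m ≤ N → f m ≈ g m) → sumTo N f ≈ sumTo N g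
  sumTo-cong zero    f≈g = f≈g 0 z≤n
  sumTo-cong (suc N) f≈g = +-cong (sumTo-cong N (λ m m≤N → f≈g m (ℕP.m≤n⇒m≤1+n m≤N))) (f≈g (suc N) ℕP.≤-refl)

  *-distribˡ-sumTo : ∀ N x (f : ℕ → Carrier) → x * sumTo N f ≈ sumTo N (λ m → x * f m)
  *-distribˡ-sumTo zero    x f = refl
  *-distribˡ-sumTo (suc N) x f = trans (distribˡ _ _ _) (+-cong (*-distribˡ-sumTo N x f) refl)

  sumTo-+ : ∀ N (f g : ℕ → Carrier) → sumTo N (λ m → f m + g m) ≈ sumTo N f + sumTo N g
  sumTo-+ zero    f g = refl
  sumTo-+ (suc N) f g = trans (+-cong (sumTo-+ N f g) refl)
    (solve 4 (λ a b c d → (a :+ b) :+ (c :+ d) := (a :+ c) :+ (b :+ d)) refl _ _ _ _)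

  sumTo-*-− : ∀ N x y (f g : ℕ → Carrier) →
              sumTo N (λ m → (x * f m) − (y * g m)) ≈ (x * sumTo N f) − (y * sumTo N g)
  sumTo-*-− zero    x y f g = refl
  sumTo-*-− (suc N) x y f g = trans (+-cong (sumTo-*-− N x y f g) refl)
    (solve 6 (λ x y F G f g → (x :* F :- y :* G) :+ (x :* f :- y :* g) := x :* (F :+ f) :- y :* (G :+ g))
           refl x y (sumTo N f) (sumTo N g) (f (suc N)) (g (suc N)))

  sumTo-telescope : ∀ N (f G : ℕ → Carrier) → (∀ m → m ≤ N → f m ≈ G (suc m) − G m) →
                    sumTo N f ≈ G (suc N) − G 0
  sumTo-telescope zero    f G f≈ΔG = f≈ΔG 0 z≤n
  sumTo-telescope (suc N) f G f≈ΔG = begin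
    sumTo N f + f (suc N)                              ≈⟨ +-cong (sumTo-telescope N f G (λ m m≤N → f≈ΔG m (ℕP.m≤n⇒m≤1+n m≤N)))
                                                                 (f≈ΔG (suc N) ℕP.≤-refl) ⟩
    (G (suc N) − G 0) + (G (suc (suc N)) − G (suc N)) ≈⟨ solve 3 (λ a b c → (b :- a) :+ (c :- b) := c :- a)
                                                         refl (G 0) (G (suc N)) (G (suc (suc N))) ⟩
    G (suc (suc N)) − G 0                              ∎

  sumTo-vanishing-tail : ∀ {N} M (f : ℕ → Carrier) → N ≤ M → (∀ m → N < m → f m ≈ 0#) → sumTo M f ≈ sumTo N f
  sumTo-vanishing-tail {N} M f N≤M f≈0 with ℕP.m≤n⇒m<n∨m≡n N≤M
  sumTo-vanishing-tail {N} (suc M) f N≤M f≈0 | inj₁ (s≤s N≤M′) =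
    trans (+-cong refl (f≈0 (suc M) (s≤s N≤M′))) (trans (+-identityʳ _) (sumTo-vanishing-tail M f N≤M′ f≈0))
  sumTo-vanishing-tail M f N≤M f≈0 | inj₂ ≡.refl = refl

  sumTo-triangle : ∀ n (F : ℕ → ℕ → Carrier) →
    sumTo n (λ k → sumTo k (F k)) ≈ sumTo n (λ m → sumTo (n ∸ m) (λ j → F (m ℕ.+ j) m))
  sumTo-triangle zero    F = refl
  sumTo-triangle (suc n) F = begin
    sumTo n (λ k → sumTo k (F k)) + sumTo (suc n) (F (suc n))
      ≈⟨ +-cong (sumTo-triangle n F) refl ⟩
    sumTo n inner + (sumTo n (F (suc n)) + F (suc n) (suc n))
      ≈⟨ sym (+-assoc _ _ _) ⟩
    (sumTo n inner + sumTo n (F (suc n))) + F (suc n) (suc n)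
      ≈⟨ +-cong (sym (sumTo-+ n _ _)) diagonal ⟩
    sumTo n (λ m → inner m + F (suc n) m) + sumTo (suc n ∸ suc n) (λ j → F (suc n ℕ.+ j) (suc n))
      ≈⟨ +-cong (sumTo-cong n extend) refl ⟩
    sumTo (suc n) (λ m → sumTo (suc n ∸ m) (λ j → F (m ℕ.+ j) m)) ∎
    where
    inner : ℕ → Carrier
    inner m = sumTo (n ∸ m) (λ j → F (m ℕ.+ j) m)
    diagonal : F (suc n) (suc n) ≈ sumTo (suc n ∸ suc n) (λ j → F (suc n ℕ.+ j) (suc n))
    diagonal rewrite ℕP.n∸n≡0 n | ℕP.+-identityʳ n = refl
    extend : ∀ m → m ≤ n → inner m + F (suc n) m ≈ sumTo (suc n ∸ m) (λ j → F (m ℕ.+ j) m)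
    extend m m≤n rewrite ℕP.+-∸-assoc 1 m≤n =
      +-cong refl (reflexive (≡.cong (λ k → F k m) (≡.sym (≡.trans (ℕP.+-suc m (n ∸ m)) (≡.cong suc (ℕP.m+[n∸m]≡n m≤n))))))

module PfaffSaalschütz {c′ ℓ : Level} (K : CharZeroField c′ ℓ) where
  open FieldArithmetic K
  open Pochhammer K
  open FiniteSums K

  saalTerm : ℕ → Carrier → Carrier → Carrier → Carrier → ℕ → Carrier
  saalTerm N A B C D j = ((poch (- ι N) j * poch A j) * poch B j) / ((fact j * poch C j) * poch D j)

  saalTerm-zero : ∀ N A B C D → saalTerm N A B C D 0 ≈ 1#
  saalTerm-zero N A B C D = /-≈-self den≉0 (trans (*-identityʳ _) (trans (*-identityʳ _) (sym den≈1)))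
    where
    den≈1 : (fact 0 * 1#) * 1# ≈ 1#
    den≈1 = trans (*-identityʳ _) (trans (*-identityʳ _) (trans (*-identityʳ _) (+-identityʳ 1#)))
    den≉0 : (fact 0 * 1#) * 1# ≉ 0#
    den≉0 = ≉0-resp (sym den≈1) 1≉0

  saalDen-≉0 : ∀ {C D} j → NotNegIntBelow j C → NotNegIntBelow j D → (fact j * poch C j) * poch D j ≉ 0#
  saalDen-≉0 j hC hD = *-≉0 (*-≉0 (fact-≉0 j) (poch-≉0 j hC)) (poch-≉0 j hD)

  saalTerm-suc : ∀ N A B C D j → NotNegIntBelow (suc j) C → NotNegIntBelow (suc j) D →
    saalTerm N A B C D (suc j) * (((ι 1 + ι j) * (C + ι j)) * (D + ι j))
      ≈ saalTerm N A B C D j * ((((- ι N) + ι j) * (A + ι j)) * (B + ι j))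
  saalTerm-suc N A B C D j hC hD = /-ratio
    (solve 6 (λ px pa pb u v w → ((px :* u) :* (pa :* v)) :* (pb :* w) := ((px :* pa) :* pb) :* ((u :* v) :* w))
           refl (poch (- ι N) j) (poch A j) (poch B j) ((- ι N) + ι j) (A + ι j) (B + ι j))
    (solve 6 (λ f pc pd k u w → ((# 1 :* (f :* (# 1 :+ k))) :* (pc :* u)) :* (pd :* w) := (((# 1 :* f) :* pc) :* pd) :* (((# 1 :+ k) :* u) :* w))
           refl (poch (ι 1) j) (poch C j) (poch D j) (ι j) (C + ι j) (D + ι j))
    (saalDen-≉0 j (NotNegIntBelow-≤ (ℕP.n≤1+n j) hC) (NotNegIntBelow-≤ (ℕP.n≤1+n j) hD))
    (*-≉0 (*-≉0 (1+ι≉0 j) (hC j ℕP.≤-refl)) (hD j ℕP.≤-refl))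

  saalTerm-suc-N : ∀ N A B C D j → NotNegIntBelow (suc j) C → D ≉ 0# → NotNegIntBelow j (D + ι 1) →
    saalTerm (suc N) A B C D (suc j) * (((ι 1 + ι j) * (C + ι j)) * D)
      ≈ saalTerm N A B C (D + ι 1) j * (((- (ι 1 + ι N)) * (A + ι j)) * (B + ι j))
  saalTerm-suc-N N A B C D j hC D≉0 hD = /-ratio num den
    (saalDen-≉0 j (NotNegIntBelow-≤ (ℕP.n≤1+n j) hC) hD)
    (*-≉0 (*-≉0 (1+ι≉0 j) (hC j ℕP.≤-refl)) D≉0)
    where
    −N−1 : - ι (suc N) ≈ - (ι 1 + ι N)
    −N−1 = -‿cong (ι-+ 1 N)
    num : (poch (- ι (suc N)) (suc j) * poch A (suc j)) * poch B (suc j)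
          ≈ ((poch (- ι N) j * poch A j) * poch B j) * (((- (ι 1 + ι N)) * (A + ι j)) * (B + ι j))
    num = begin
      (poch (- ι (suc N)) (suc j) * poch A (suc j)) * poch B (suc j)
        ≈⟨ *-cong (*-cong (trans (poch-sucˡ _ j) (*-cong −N−1 (poch-cong j (trans (+-cong −N−1 refl)
             (solve 1 (λ n → :- (# 1 :+ n) :+ # 1 := :- n) refl (ι N)))))) refl) refl ⟩
      ((- (ι 1 + ι N)) * poch (- ι N) j * (poch A j * (A + ι j))) * (poch B j * (B + ι j))
        ≈⟨ solve 6 (λ v p pa pb a b → ((v :* p) :* (pa :* a)) :* (pb :* b) := ((p :* pa) :* pb) :* ((v :* a) :* b))
                 refl (- (ι 1 + ι N)) (poch (- ι N) j) (poch A j) (poch B j) (A + ι j) (B + ι j) ⟩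
      ((poch (- ι N) j * poch A j) * poch B j) * (((- (ι 1 + ι N)) * (A + ι j)) * (B + ι j)) ∎
    den : (fact (suc j) * poch C (suc j)) * poch D (suc j)
          ≈ ((fact j * poch C j) * poch (D + ι 1) j) * (((ι 1 + ι j) * (C + ι j)) * D)
    den = begin
      (fact (suc j) * poch C (suc j)) * poch D (suc j)
        ≈⟨ *-cong refl (poch-sucˡ D j) ⟩
      (fact (suc j) * poch C (suc j)) * (D * poch (D + ι 1) j)
        ≈⟨ solve 6 (λ f pc pd k u d → ((# 1 :* (f :* (# 1 :+ k))) :* (pc :* u)) :* (d :* pd) := (((# 1 :* f) :* pc) :* pd) :* (((# 1 :+ k) :* u) :* d))
                 refl (poch (ι 1) j) (poch C j) (poch (D + ι 1) j) (ι j) (C + ι j) D ⟩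
      ((fact j * poch C j) * poch (D + ι 1) j) * (((ι 1 + ι j) * (C + ι j)) * D) ∎

  saalTerm-vanish : ∀ {N j} A B C D → N < j → saalTerm N A B C D j ≈ 0#
  saalTerm-vanish A B C D N<j =
    trans (*-cong (trans (*-cong (trans (*-cong (poch-−ι-vanish N<j) refl) (zeroˡ _)) refl) (zeroˡ _)) refl) (zeroˡ _)

  -- The contiguous relation between the sums for (N + 1, D) and (N, D + 1), by creative telescoping
  -- with certificate G (j + 1) = -(A + j)(B + j) t j.
  module Contiguity (N : ℕ) (A B C D : Carrier) (balanced : D + ι (suc N) ≈ ((ι 1 + A) + B) − C)
                    (hC : NotNegIntBelow (suc N) C) (hD : NotNegIntBelow (suc N) D) where

    L R : Carrier
    L = (C + ι N) * (((C − A) − B) + ι N)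
    R = ((C − A) + ι N) * ((C − B) + ι N)

    t t′ G : ℕ → Carrier
    t  = saalTerm N A B C (D + ι 1)
    t′ = saalTerm (suc N) A B C D
    G zero    = 0#
    G (suc j) = (- ((A + ι j) * (B + ι j))) * t j

    t-vanish : ∀ {j} → N < j → t j ≈ 0#
    t-vanish = saalTerm-vanish A B C (D + ι 1)

    balanced′ : D + (ι 1 + ι N) ≈ ((ι 1 + A) + B) − C
    balanced′ = trans (+-cong refl (sym (ι-+ 1 N))) balanced

    D≉0 : D ≉ 0#
    D≉0 = ≉0-resp (+-identityʳ D) (hD 0 (s≤s z≤n))

    hD+1 : NotNegIntBelow N (D + ι 1)
    hD+1 = NotNegIntBelow-shift 1 N hD

    ΔG-zero : (L * t′ 0) − (R * t 0) ≈ G 1 − G 0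
    ΔG-zero = begin
      (L * t′ 0) − (R * t 0)  ≈⟨ +-cong (*-cong refl (trans (saalTerm-zero (suc N) A B C D) (sym (saalTerm-zero N A B C (D + ι 1))))) refl ⟩
      (L * t 0) − (R * t 0)   ≈⟨ solve 5 (λ t A B C N → (((C :+ N) :* (((C :- A) :- B) :+ N)) :* t) :- ((((C :- A) :+ N) :* ((C :- B) :+ N)) :* t)
                                        := ((:- ((A :+ # 0) :* (B :+ # 0))) :* t) :- # 0) refl (t 0) A B C (ι N) ⟩
      G 1 − G 0               ∎

    -- A linear combination of the two ratio relations and the balancing condition.
    ΔG-suc : ∀ J → J < N → (L * t′ (suc J)) − (R * t (suc J)) ≈ G (suc (suc J)) − G (suc J)
    ΔG-suc J J<N = *-cancelʳ W≉0
      (trans (solve 9 (λ t₀ t₁ t′₁ A B C D N J →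
         let L  = (C :+ N) :* (((C :- A) :- B) :+ N)
             R  = ((C :- A) :+ N) :* ((C :- B) :+ N)
             P  = (A :+ J) :* (B :+ J)
             P₁ = (A :+ (# 1 :+ J)) :* (B :+ (# 1 :+ J))
             c₁ = (# 1 :+ J) :* (C :+ J)
             W  = (c₁ :* D) :* ((D :+ # 1) :+ J)
         in ((L :* t′₁) :- (R :* t₁)) :* W
            := ((((:- P₁) :* t₁) :- ((:- P) :* t₀)) :* W
                 :+ ((t′₁ :* (c₁ :* D)) :- (t₀ :* (((:- (# 1 :+ N)) :* (A :+ J)) :* (B :+ J)))) :* (L :* ((D :+ # 1) :+ J))
                 :+ ((t₁ :* (c₁ :* ((D :+ # 1) :+ J))) :- (t₀ :* ((((:- N) :+ J) :* (A :+ J)) :* (B :+ J)))) :* ((P₁ :- R) :* D))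
               :+ ((D :+ (# 1 :+ N)) :- (((# 1 :+ A) :+ B) :- C))
                  :* ((t₀ :* P) :* ((D :* (N :- J)) :* (((C :+ N) :+ # 1) :+ J) :- ((# 1 :+ N) :* (C :+ N)) :* ((D :+ # 1) :+ J))))
         refl (t J) (t (suc J)) (t′ (suc J)) A B C D (ι N) (ι J))
      (trans (x+[u−v]*y≈x _ balanced′)
      (trans (x+[u−v]*y≈x _ (saalTerm-suc N A B C (D + ι 1) J (NotNegIntBelow-≤ sJ≤sN hC) (NotNegIntBelow-≤ J<N hD+1)))
      (trans (x+[u−v]*y≈x _ (saalTerm-suc-N N A B C D J (NotNegIntBelow-≤ sJ≤sN hC) D≉0 (NotNegIntBelow-≤ (ℕP.<⇒≤ J<N) hD+1)))
             (*-cong (+-cong (*-cong (-‿cong (*-cong (+-cong refl (sym (ι-+ 1 J))) (+-cong refl (sym (ι-+ 1 J))))) refl) refl) refl)))))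
      where
      sJ≤sN : suc J ≤ suc N
      sJ≤sN = ℕP.<⇒≤ (s≤s J<N)
      W≉0 : (((ι 1 + ι J) * (C + ι J)) * D) * ((D + ι 1) + ι J) ≉ 0#
      W≉0 = *-≉0 (*-≉0 (*-≉0 (1+ι≉0 J) (hC J (ℕP.m<n⇒m<1+n J<N))) D≉0) (hD+1 J J<N)

    -- As ΔG-suc, but D + 1 + N may vanish here: t (N + 1) = 0 replaces the first ratio relation.
    ΔG-last : (L * t′ (suc N)) − (R * t (suc N)) ≈ G (suc (suc N)) − G (suc N)
    ΔG-last = *-cancelʳ W≉0
      (trans (solve 9 (λ t₀ t₁ t′₁ A B C D N N₁ →
         let L  = (C :+ N) :* (((C :- A) :- B) :+ N)
             R  = ((C :- A) :+ N) :* ((C :- B) :+ N)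
             P  = (A :+ N) :* (B :+ N)
             P₁ = (A :+ N₁) :* (B :+ N₁)
             W  = ((# 1 :+ N) :* (C :+ N)) :* D
         in ((L :* t′₁) :- (R :* t₁)) :* W
            := ((((:- P₁) :* t₁) :- ((:- P) :* t₀)) :* W
                 :+ ((t′₁ :* W) :- (t₀ :* (((:- (# 1 :+ N)) :* (A :+ N)) :* (B :+ N)))) :* L
                 :+ (t₁ :- # 0) :* ((P₁ :- R) :* W))
               :+ ((D :+ (# 1 :+ N)) :- (((# 1 :+ A) :+ B) :- C)) :* (:- (((t₀ :* P) :* (# 1 :+ N)) :* (C :+ N))))
         refl (t N) (t (suc N)) (t′ (suc N)) A B C D (ι N) (ι (suc N)))
      (trans (x+[u−v]*y≈x _ balanced′)
      (trans (x+[u−v]*y≈x _ (t-vanish ℕP.≤-refl))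
             (x+[u−v]*y≈x _ (saalTerm-suc-N N A B C D N hC D≉0 hD+1)))))
      where
      W≉0 : ((ι 1 + ι N) * (C + ι N)) * D ≉ 0#
      W≉0 = *-≉0 (*-≉0 (1+ι≉0 N) (hC N ℕP.≤-refl)) D≉0

    ΔG : ∀ j → j ≤ suc N → (L * t′ j) − (R * t j) ≈ G (suc j) − G j
    ΔG zero    _      = ΔG-zero
    ΔG (suc J) sJ≤sN with ℕP.m≤n⇒m<n∨m≡n (ℕP.≤-pred sJ≤sN)
    ... | inj₁ J<N    = ΔG-suc J J<N
    ... | inj₂ ≡.refl = ΔG-last

    contiguous : L * sumTo (suc N) t′ ≈ R * sumTo N t
    contiguous = x−y≈0⇒x≈y (begin
      (L * sumTo (suc N) t′) − (R * sumTo N t)         ≈⟨ +-cong refl (-‿cong (*-cong refl (sym t-tail))) ⟩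
      (L * sumTo (suc N) t′) − (R * sumTo (suc N) t)   ≈⟨ sym (sumTo-*-− (suc N) L R t′ t) ⟩
      sumTo (suc N) (λ j → (L * t′ j) − (R * t j))     ≈⟨ sumTo-telescope (suc N) _ G ΔG ⟩
      G (suc (suc N)) − G 0                            ≈⟨ +-cong (trans (*-cong refl (t-vanish ℕP.≤-refl)) (zeroʳ _)) -0#≈0# ⟩
      0# + 0#                                          ≈⟨ +-identityʳ 0# ⟩
      0#                                               ∎)
      where
      t-tail : sumTo (suc N) t ≈ sumTo N t
      t-tail = sumTo-vanishing-tail (suc N) t (ℕP.n≤1+n N) (λ _ → t-vanish)

  pfaff-saalschütz : ∀ N A B C D → D + ι N ≈ ((ι 1 + A) + B) − C →
    NotNegIntBelow N C → NotNegIntBelow N D →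
    sumTo N (saalTerm N A B C D) * (poch C N * poch ((C − A) − B) N) ≈ poch (C − A) N * poch (C − B) N
  pfaff-saalschütz zero    A B C D _ _ _ = trans (*-cong (saalTerm-zero 0 A B C D) refl) (*-identityˡ _)
  pfaff-saalschütz (suc N) A B C D balanced hC hD = begin
    S′ * ((poch C N * (C + ι N)) * (poch E N * (E + ι N)))
      ≈⟨ solve 5 (λ s pc u pe v → s :* ((pc :* u) :* (pe :* v)) := ((u :* v) :* s) :* (pc :* pe))
               refl S′ (poch C N) (C + ι N) (poch E N) (E + ι N) ⟩
    (((C + ι N) * (E + ι N)) * S′) * (poch C N * poch E N)
      ≈⟨ *-cong (Contiguity.contiguous N A B C D balanced hC hD) refl ⟩
    (R * S) * (poch C N * poch E N)
      ≈⟨ *-assoc _ _ _ ⟩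
    R * (S * (poch C N * poch E N))
      ≈⟨ *-cong refl (pfaff-saalschütz N A B C (D + ι 1) balanced↓ (NotNegIntBelow-≤ (ℕP.n≤1+n N) hC) (NotNegIntBelow-shift 1 N hD)) ⟩
    R * (poch (C − A) N * poch (C − B) N)
      ≈⟨ solve 4 (λ x y u v → (u :* v) :* (x :* y) := (x :* u) :* (y :* v))
         refl (poch (C − A) N) (poch (C − B) N) ((C − A) + ι N) ((C − B) + ι N) ⟩
    poch (C − A) (suc N) * poch (C − B) (suc N) ∎
    where
    E R S S′ : Carrier
    E  = (C − A) − B
    R  = ((C − A) + ι N) * ((C − B) + ι N)
    S  = sumTo N (saalTerm N A B C (D + ι 1))
    S′ = sumTo (suc N) (saalTerm (suc N) A B C D)
    balanced↓ : (D + ι 1) + ι N ≈ ((ι 1 + A) + B) − C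
    balanced↓ = trans (trans (+-assoc _ _ _) (+-cong refl (sym (ι-+ 1 N)))) balanced

module FourF3Summation {c′ ℓ : Level} (K : CharZeroField c′ ℓ) (a b : CharZeroField.Carrier K) where
  open FieldArithmetic K
  open Pochhammer K
  open FiniteSums K

  p₁ p₂ q₁ q₂ q₃ : Carrier
  p₁ = (a − b) * half
  p₂ = ((ι 1 + a) − b) * half
  q₁ = a * half
  q₂ = (ι 1 + a) − b
  q₃ = (ι 1 + a) * half

  weight : ℕ → Carrier
  weight m = (poch p₁ m * poch p₂ m) / (fact m * ((poch q₁ m * poch q₂ m) * poch q₃ m))

  lead : ℕ → ℕ → Carrier
  lead n m = poch (- ι n) m * poch (ι n + a) m

  term : ℕ → ℕ → Carrier
  term n m = lead n m * weight m

  series : ℕ → Carrier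
  series n = sumTo n (term n)

  weight-zero : weight 0 ≈ ι 1
  weight-zero = trans (/-≈-self den≉0 (sym den≈1*1)) 1≈ι1
    where
    den≈1*1 : fact 0 * ((1# * 1#) * 1#) ≈ 1# * 1#
    den≈1*1 = trans (*-cong (trans (*-identityʳ _) (sym 1≈ι1)) (*-identityʳ _)) (*-identityˡ _)
    den≉0 : fact 0 * ((1# * 1#) * 1#) ≉ 0#
    den≉0 = ≉0-resp (sym (trans den≈1*1 (*-identityʳ 1#))) 1≉0

  term-zero : ∀ n → term n 0 ≈ ι 1
  term-zero n = trans (*-cong (*-identityˡ _) weight-zero) (*-identityˡ _)

  term-vanish : ∀ {n m} → n < m → term n m ≈ 0#
  term-vanish n<m = trans (*-cong (trans (*-cong (poch-−ι-vanish n<m) refl) (zeroˡ _)) refl) (zeroˡ _)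

  lead-shift₀ : ∀ n M → lead n (suc M) * (- (ι 1 + ι n))
    ≈ lead (suc n) M * ((((- (ι 1 + ι n)) + ι M) * ((- ι n) + ι M)) * (ι n + a))
  lead-shift₀ n M = begin
    (poch (- ι n) M * ((- ι n) + ι M)) * poch (ι n + a) (suc M) * (- (ι 1 + ι n))
      ≈⟨ *-cong (*-cong refl (poch-sucˡ′ M (trans (solve 2 (λ n a → (n :+ a) :+ # 1 := (# 1 :+ n) :+ a) refl (ι n) a)
                                                   (+-cong (sym (ι-+ 1 n)) refl)))) (-‿cong (sym (ι-+ 1 n))) ⟩
    (poch (- ι n) M * ((- ι n) + ι M)) * ((ι n + a) * poch y M) * w
      ≈⟨ solve 5 (λ p u x q w → (p :* u) :* (x :* q) :* w := ((w :* p) :* q) :* (u :* x))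
         refl (poch (- ι n) M) ((- ι n) + ι M) (ι n + a) (poch y M) w ⟩
    ((w * poch (- ι n) M) * poch y M) * (((- ι n) + ι M) * (ι n + a))
      ≈⟨ *-cong (*-cong (sym (poch-sucˡ′ M (trans (+-cong (-‿cong (ι-+ 1 n)) refl)
                                               (solve 1 (λ n → :- (# 1 :+ n) :+ # 1 := :- n) refl (ι n))))) refl) refl ⟩
    ((poch w M * (w + ι M)) * poch y M) * (((- ι n) + ι M) * (ι n + a))
      ≈⟨ solve 5 (λ p u q v x → ((p :* u) :* q) :* (v :* x) := (p :* q) :* ((u :* v) :* x))
         refl (poch w M) (w + ι M) (poch y M) ((- ι n) + ι M) (ι n + a) ⟩
    lead (suc n) M * (((w + ι M) * ((- ι n) + ι M)) * (ι n + a))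
      ≈⟨ *-cong refl (*-cong (*-cong (+-cong (-‿cong (ι-+ 1 n)) refl) refl) refl) ⟩
    lead (suc n) M * ((((- (ι 1 + ι n)) + ι M) * ((- ι n) + ι M)) * (ι n + a)) ∎
    where
    w y : Carrier
    w = - ι (suc n)
    y = ι (suc n) + a

  lead-shift₁ : ∀ n M → lead (suc n) (suc M) ≈ lead (suc n) M * (((- (ι 1 + ι n)) + ι M) * (((ι 1 + ι n) + a) + ι M))
  lead-shift₁ n M = trans
    (solve 4 (λ p u q v → (p :* u) :* (q :* v) := (p :* q) :* (u :* v))
        refl (poch (- ι (suc n)) M) ((- ι (suc n)) + ι M) (poch (ι (suc n) + a) M) ((ι (suc n) + a) + ι M))
    (*-cong refl (*-cong (+-cong (-‿cong (ι-+ 1 n)) refl) (+-cong (+-cong (ι-+ 1 n) refl) refl)))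

  lead-shift₂ : ∀ n M → lead (suc (suc n)) (suc M) * ((ι 1 + ι n) + a)
    ≈ lead (suc n) M * ((- (ι 2 + ι n)) * ((((ι 1 + ι n) + a) + ι M) * (((ι 2 + ι n) + a) + ι M)))
  lead-shift₂ n M = begin
    (poch w₂ (suc M) * poch y₂ (suc M)) * ((ι 1 + ι n) + a)
      ≈⟨ *-cong (*-cong (poch-sucˡ′ M w₂+1≈w) refl) (sym y≈) ⟩
    ((w₂ * poch w M) * poch y₂ (suc M)) * y
      ≈⟨ solve 4 (λ w₂ p q y → (w₂ :* p) :* q :* y := w₂ :* p :* (y :* q)) refl w₂ (poch w M) (poch y₂ (suc M)) y ⟩
    (w₂ * poch w M) * (y * poch y₂ (suc M))
      ≈⟨ *-cong refl (sym (poch-sucˡ′ (suc M) y+1≈y₂)) ⟩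
    (w₂ * poch w M) * ((poch y M * (y + ι M)) * (y + ι (suc M)))
      ≈⟨ solve 5 (λ w₂ p q u v → (w₂ :* p) :* ((q :* u) :* v) := (p :* q) :* (w₂ :* (u :* v)))
         refl w₂ (poch w M) (poch y M) (y + ι M) (y + ι (suc M)) ⟩
    lead (suc n) M * (w₂ * ((y + ι M) * (y + ι (suc M))))
      ≈⟨ *-cong refl (*-cong (-‿cong (ι-+ 2 n)) (*-cong (+-cong y≈ refl) y+1+M≈)) ⟩
    lead (suc n) M * ((- (ι 2 + ι n)) * ((((ι 1 + ι n) + a) + ι M) * (((ι 2 + ι n) + a) + ι M))) ∎
    where
    w w₂ y y₂ : Carrier
    w  = - ι (suc n)
    w₂ = - ι (suc (suc n))
    y  = ι (suc n) + a
    y₂ = ι (suc (suc n)) + a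
    y≈ : y ≈ (ι 1 + ι n) + a
    y≈ = +-cong (ι-+ 1 n) refl
    y+1≈y₂ : y + ι 1 ≈ y₂
    y+1≈y₂ = trans (+-cong y≈ refl) (trans (solve 2 (λ n a → ((# 1 :+ n) :+ a) :+ # 1 := (# 2 :+ n) :+ a) refl (ι n) a)
                                           (+-cong (sym (ι-+ 2 n)) refl))
    w₂+1≈w : w₂ + ι 1 ≈ w
    w₂+1≈w = trans (+-cong (-‿cong (ι-+ 1 (suc n))) refl) (solve 1 (λ n → :- (# 1 :+ n) :+ # 1 := :- n) refl (ι (suc n)))
    y+1+M≈ : y + ι (suc M) ≈ ((ι 2 + ι n) + a) + ι M
    y+1+M≈ = trans (+-cong y≈ (ι-+ 1 M)) (solve 3 (λ n a m → ((# 1 :+ n) :+ a) :+ (# 1 :+ m) := ((# 2 :+ n) :+ a) :+ m) refl (ι n) a (ι M))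

  twice+ : ∀ {x y} m → x + x ≈ y → (ι 2 * m) + y ≈ (x + m) + (x + m)
  twice+ {x} m x+x≈y = trans (+-cong refl (sym x+x≈y)) (solve 2 (λ x m → (# 2 :* m) :+ (x :+ x) := (x :+ m) :+ (x :+ m)) refl x m)

  -- 4 · weight (M + 1) / weight M = E M / Den M.
  E Den : ℕ → Carrier
  E M   = ((ι 2 * ι M) + (a − b)) * (((ι 2 * ι M) + ι 1) + (a − b))
  Den M = (((ι 1 + ι M) * ((ι 2 * ι M) + a)) * (q₂ + ι M)) * (((ι 2 * ι M) + ι 1) + a)

  -- The coefficients of the recurrence of series, as found by Zeilberger's algorithm.
  P₀ P₁ P₂ : ℕ → Carrier
  P₀ n = (ι n + ι 1) * (ι n + b)
  P₁ n = - (((a + ι n) * (ι n + ι 1)) + ((((ι n + a) − b) + ι 2) * ((ι n + b) + ι 1)))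
  P₂ n = ((ι n + a) + ι 1) * (((ι n + a) − b) + ι 2)

  module _ (a≉-ℕ : ∀ j → a + ι j ≉ 0#) where

    q₁+ι≉0 : ∀ j → q₁ + ι j ≉ 0#
    q₁+ι≉0 j = *half+ι≉0 a j (a≉-ℕ (j ℕ.+ j))

    q₃+ι≉0 : ∀ j → q₃ + ι j ≉ 0#
    q₃+ι≉0 j = *half+ι≉0 (ι 1 + a) j (≉0-resp a+1+2j≈ (a≉-ℕ (suc (j ℕ.+ j))))
      where
      a+1+2j≈ : a + ι (suc (j ℕ.+ j)) ≈ (ι 1 + a) + ι (j ℕ.+ j)
      a+1+2j≈ = trans (+-cong refl (ι-+ 1 (j ℕ.+ j))) (solve 2 (λ a t → a :+ (# 1 :+ t) := (# 1 :+ a) :+ t) refl a (ι (j ℕ.+ j)))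

    weightDen-≉0 : ∀ M → NotNegIntBelow M q₂ → fact M * ((poch q₁ M * poch q₂ M) * poch q₃ M) ≉ 0#
    weightDen-≉0 M h₂ =
      *-≉0 (fact-≉0 M) (*-≉0 (*-≉0 (poch-≉0 M (λ j _ → q₁+ι≉0 j)) (poch-≉0 M h₂)) (poch-≉0 M (λ j _ → q₃+ι≉0 j)))

    weight-suc : ∀ M → NotNegIntBelow (suc M) q₂ →
      weight (suc M) * ((((ι 1 + ι M) * (q₁ + ι M)) * (q₂ + ι M)) * (q₃ + ι M)) ≈ weight M * ((p₁ + ι M) * (p₂ + ι M))
    weight-suc M h₂ = /-ratio
      (solve 4 (λ x y u v → (x :* u) :* (y :* v) := (x :* y) :* (u :* v)) refl (poch p₁ M) (poch p₂ M) (p₁ + ι M) (p₂ + ι M))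
      (solve 8 (λ f m y₁ y₂ y₃ x₁ x₂ x₃ → (# 1 :* (f :* (# 1 :+ m))) :* (((y₁ :* x₁) :* (y₂ :* x₂)) :* (y₃ :* x₃))
                                       := (# 1 :* f :* ((y₁ :* y₂) :* y₃)) :* ((((# 1 :+ m) :* x₁) :* x₂) :* x₃))
             refl (poch (ι 1) M) (ι M) (poch q₁ M) (poch q₂ M) (poch q₃ M) (q₁ + ι M) (q₂ + ι M) (q₃ + ι M))
      (weightDen-≉0 M (NotNegIntBelow-≤ (ℕP.n≤1+n M) h₂))
      (*-≉0 (*-≉0 (*-≉0 (1+ι≉0 M) (q₁+ι≉0 M)) (h₂ M ℕP.≤-refl)) (q₃+ι≉0 M))

    -- weight-suc multiplied by 4, which clears the halves.
    weight-suc-cleared : ∀ M → NotNegIntBelow (suc M) q₂ → weight (suc M) * Den M ≈ weight M * E M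
    weight-suc-cleared M h₂ = begin
      weight (suc M) * Den M                      ≈⟨ *-cong refl Den≈ ⟩
      weight (suc M) * (ι 4 * den)                ≈⟨ solve 3 (λ u v w → u :* (v :* w) := v :* (u :* w)) refl (weight (suc M)) (ι 4) den ⟩
      ι 4 * (weight (suc M) * den)                ≈⟨ *-cong refl (weight-suc M h₂) ⟩
      ι 4 * (weight M * num)                      ≈⟨ solve 3 (λ u v w → u :* (v :* w) := v :* (u :* w)) refl (ι 4) (weight M) num ⟩
      weight M * (ι 4 * num)                      ≈⟨ *-cong refl (sym E≈) ⟩
      weight M * E M                              ∎
      where
      m den num : Carrier
      m   = ι M
      den = (((ι 1 + m) * (q₁ + m)) * (q₂ + m)) * (q₃ + m)
      num = (p₁ + m) * (p₂ + m)
      Den≈ : Den M ≈ ι 4 * den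
      Den≈ = begin
        (((ι 1 + m) * ((ι 2 * m) + a)) * (q₂ + m)) * (((ι 2 * m) + ι 1) + a)
          ≈⟨ *-cong (*-cong (*-cong refl (twice+ m (x*half+x*half≈x a))) refl)
                    (trans (solve 2 (λ m a → ((# 2 :* m) :+ # 1) :+ a := (# 2 :* m) :+ (# 1 :+ a)) refl m a) (twice+ m (x*half+x*half≈x (ι 1 + a)))) ⟩
        (((ι 1 + m) * ((q₁ + m) + (q₁ + m))) * (q₂ + m)) * ((q₃ + m) + (q₃ + m))
          ≈⟨ solve 4 (λ u x w z → ((u :* (x :+ x)) :* w) :* (z :+ z) := # 4 :* (((u :* x) :* w) :* z))
             refl (ι 1 + m) (q₁ + m) (q₂ + m) (q₃ + m) ⟩
        ι 4 * den ∎
      E≈ : E M ≈ ι 4 * num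
      E≈ = begin
        ((ι 2 * m) + (a − b)) * (((ι 2 * m) + ι 1) + (a − b))
          ≈⟨ *-cong (twice+ m (x*half+x*half≈x (a − b)))
                    (trans (solve 3 (λ m a b → ((# 2 :* m) :+ # 1) :+ (a :- b) := (# 2 :* m) :+ ((# 1 :+ a) :- b)) refl m a b)
                           (twice+ m (x*half+x*half≈x ((ι 1 + a) − b)))) ⟩
        ((p₁ + m) + (p₁ + m)) * ((p₂ + m) + (p₂ + m))
          ≈⟨ solve 2 (λ x y → (x :+ x) :* (y :+ y) := # 4 :* (x :* y)) refl (p₁ + m) (p₂ + m) ⟩
        ι 4 * num ∎

    Den-≉0 : ∀ M → q₂ + ι M ≉ 0# → Den M ≉ 0#
    Den-≉0 M q₂+M≉0 = *-≉0 (*-≉0 (*-≉0 (1+ι≉0 M) (≉0-resp 2M+a≈ (a≉-ℕ (2 ℕ.* M)))) q₂+M≉0)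
                             (≉0-resp 2M+1+a≈ (a≉-ℕ (suc (2 ℕ.* M))))
      where
      2M+a≈ : a + ι (2 ℕ.* M) ≈ (ι 2 * ι M) + a
      2M+a≈ = trans (+-cong refl (ι-* 2 M)) (+-comm _ _)
      2M+1+a≈ : a + ι (suc (2 ℕ.* M)) ≈ ((ι 2 * ι M) + ι 1) + a
      2M+1+a≈ = trans (+-cong refl (trans (ι-+ 1 (2 ℕ.* M)) (+-cong refl (ι-* 2 M))))
                      (solve 2 (λ a t → a :+ (# 1 :+ t) := (t :+ # 1) :+ a) refl a (ι 2 * ι M))

    -- The three-term recurrence of series in n, by creative telescoping with certificate
    -- G (M + 1) = E M · term (n + 1) M.
    module Recurrence (n : ℕ) (h₂ : NotNegIntBelow (suc (suc n)) q₂) where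

      n₂ : ℕ
      n₂ = suc (suc n)

      T G : ℕ → Carrier
      T m = ((P₀ n * term n m) + (P₁ n * term (suc n) m)) + (P₂ n * term n₂ m)
      G zero    = 0#
      G (suc M) = E M * term (suc n) M

      ΔG-zero : T 0 ≈ G 1 − G 0
      ΔG-zero = begin
        T 0
          ≈⟨ +-cong (+-cong (*-cong refl (term-zero n)) (*-cong refl (term-zero (suc n)))) (*-cong refl (term-zero n₂)) ⟩
        ((P₀ n * ι 1) + (P₁ n * ι 1)) + (P₂ n * ι 1)
          ≈⟨ solve 3 (λ ν a b → (((ν :+ # 1) :* (ν :+ b)) :* # 1
                                  :+ (:- (((a :+ ν) :* (ν :+ # 1)) :+ ((((ν :+ a) :- b) :+ # 2) :* ((ν :+ b) :+ # 1)))) :* # 1)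
                                  :+ (((ν :+ a) :+ # 1) :* (((ν :+ a) :- b) :+ # 2)) :* # 1
                                := ((((# 2 :* # 0) :+ (a :- b)) :* (((# 2 :* # 0) :+ # 1) :+ (a :- b))) :* # 1) :- # 0)
                   refl (ι n) a b ⟩
        (E 0 * ι 1) − ι 0
          ≈⟨ +-cong (*-cong refl (sym (term-zero (suc n)))) refl ⟩
        G 1 − G 0 ∎

      -- A linear combination of the weight ratio and the three contiguity relations of lead.
      ΔG-suc : ∀ M → suc M ≤ n₂ → T (suc M) ≈ G (suc (suc M)) − G (suc M)
      ΔG-suc M sM≤n₂ = *-cancelʳ K≉0
        (trans (solve 10 (λ ν a b m Z β β′ X₀ X₁ X₂ →
          let P₀ = (ν :+ # 1) :* (ν :+ b)
              P₁ = :- (((a :+ ν) :* (ν :+ # 1)) :+ ((((ν :+ a) :- b) :+ # 2) :* ((ν :+ b) :+ # 1)))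
              P₂ = ((ν :+ a) :+ # 1) :* (((ν :+ a) :- b) :+ # 2)
              Dn = (((# 1 :+ m) :* ((# 2 :* m) :+ a)) :* (((# 1 :+ a) :- b) :+ m)) :* (((# 2 :* m) :+ # 1) :+ a)
              Kn = ((:- (# 1 :+ ν)) :* ((# 1 :+ ν) :+ a)) :* Dn
              Em = ((# 2 :* m) :+ (a :- b)) :* (((# 2 :* m) :+ # 1) :+ (a :- b))
              E₁ = ((# 2 :* (# 1 :+ m)) :+ (a :- b)) :* (((# 2 :* (# 1 :+ m)) :+ # 1) :+ (a :- b))
          in ((P₀ :* (X₀ :* β′) :+ P₁ :* (X₁ :* β′)) :+ P₂ :* (X₂ :* β′)) :* Kn
             := (((((E₁ :* (X₁ :* β′)) :- (Em :* (Z :* β))) :* Kn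
                   :+ ((X₀ :* (:- (# 1 :+ ν))) :- (Z :* ((((:- (# 1 :+ ν)) :+ m) :* ((:- ν) :+ m)) :* (ν :+ a))))
                      :* (((P₀ :* β′) :* ((# 1 :+ ν) :+ a)) :* Dn))
                  :+ (X₁ :- (Z :* (((:- (# 1 :+ ν)) :+ m) :* (((# 1 :+ ν) :+ a) :+ m))))
                      :* (((P₁ :- E₁) :* β′) :* Kn))
                  :+ ((X₂ :* ((# 1 :+ ν) :+ a)) :- (Z :* ((:- (# 2 :+ ν)) :* ((((# 1 :+ ν) :+ a) :+ m) :* (((# 2 :+ ν) :+ a) :+ m)))))
                      :* (((P₂ :* β′) :* (:- (# 1 :+ ν))) :* Dn))
                :+ ((β′ :* Dn) :- (β :* Em)) :* (:- (Z :* Kn)))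
          refl (ι n) a b (ι M) (lead (suc n) M) (weight M) (weight (suc M)) (lead n (suc M)) (lead (suc n) (suc M)) (lead n₂ (suc M)))
        (trans (x+[u−v]*y≈x _ (weight-suc-cleared M (NotNegIntBelow-≤ sM≤n₂ h₂)))
        (trans (x+[u−v]*y≈x _ (lead-shift₂ n M))
        (trans (x+[u−v]*y≈x _ (lead-shift₁ n M))
        (trans (x+[u−v]*y≈x _ (lead-shift₀ n M))
               (*-cong (+-cong (*-cong (sym E-suc) refl) refl) refl))))))
        where
        K≉0 : ((- (ι 1 + ι n)) * ((ι 1 + ι n) + a)) * Den M ≉ 0#
        K≉0 = *-≉0 (*-≉0 (-‿≉0 (1+ι≉0 n))
                         (≉0-resp (trans (+-comm _ _) (+-cong (ι-+ 1 n) refl)) (a≉-ℕ (suc n))))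
                   (Den-≉0 M (h₂ M sM≤n₂))
        E-suc : E (suc M) ≈ ((ι 2 * (ι 1 + ι M)) + (a − b)) * (((ι 2 * (ι 1 + ι M)) + ι 1) + (a − b))
        E-suc = *-cong (+-cong (*-cong refl (ι-+ 1 M)) refl) (+-cong (+-cong (*-cong refl (ι-+ 1 M)) refl) refl)

      ΔG : ∀ m → m ≤ n₂ → T m ≈ G (suc m) − G m
      ΔG zero    _  = ΔG-zero
      ΔG (suc M) le = ΔG-suc M le

      recurrence : ((P₀ n * series n) + (P₁ n * series (suc n))) + (P₂ n * series n₂) ≈ 0#
      recurrence = begin
        ((P₀ n * series n) + (P₁ n * series (suc n))) + (P₂ n * series n₂)
          ≈⟨ +-cong (+-cong (*-cong refl (sym (tail (ℕP.m≤n⇒m≤1+n (ℕP.n≤1+n n))))) (*-cong refl (sym (tail (ℕP.n≤1+n (suc n)))))) refl ⟩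
        ((P₀ n * sumTo n₂ (term n)) + (P₁ n * sumTo n₂ (term (suc n)))) + (P₂ n * sumTo n₂ (term n₂))
          ≈⟨ +-cong (+-cong (*-distribˡ-sumTo n₂ _ _) (*-distribˡ-sumTo n₂ _ _)) (*-distribˡ-sumTo n₂ _ _) ⟩
        (sumTo n₂ (λ m → P₀ n * term n m) + sumTo n₂ (λ m → P₁ n * term (suc n) m)) + sumTo n₂ (λ m → P₂ n * term n₂ m)
          ≈⟨ sym (trans (sumTo-+ n₂ _ _) (+-cong (sumTo-+ n₂ _ _) refl)) ⟩
        sumTo n₂ T
          ≈⟨ sumTo-telescope n₂ T G ΔG ⟩
        G (suc n₂) − G 0
          ≈⟨ +-cong (trans (*-cong refl (term-vanish {suc n} {n₂} ℕP.≤-refl)) (zeroʳ _)) -0#≈0# ⟩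
        0# + 0#
          ≈⟨ +-identityʳ 0# ⟩
        0# ∎
        where
        tail : ∀ {k} → k ≤ n₂ → sumTo n₂ (term k) ≈ series k
        tail k≤n₂ = sumTo-vanishing-tail n₂ _ k≤n₂ (λ _ → term-vanish)

    series-closed-form-1 : NotNegIntBelow 1 q₂ → series 1 * poch a 1 ≈ poch b 1
    series-closed-form-1 h₂ = begin
      (term 1 0 + term 1 1) * (1# * (a + ι 0))     ≈⟨ *-cong refl (*-identityˡ _) ⟩
      (term 1 0 + term 1 1) * (a + ι 0)            ≈⟨ *-cancelʳ (Den-≉0 0 (h₂ 0 (s≤s z≤n))) cleared ⟩
      b + ι 0                                      ≈⟨ sym (*-identityˡ _) ⟩
      1# * (b + ι 0)                               ∎
      where
      cleared : ((term 1 0 + term 1 1) * (a + ι 0)) * Den 0 ≈ (b + ι 0) * Den 0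
      cleared =
        trans (solve 6 (λ a b t₁₀ X₁₁ w₀ w₁ →
          let Dn = (((# 1 :+ # 0) :* ((# 2 :* # 0) :+ a)) :* (((# 1 :+ a) :- b) :+ # 0)) :* (((# 2 :* # 0) :+ # 1) :+ a)
              E₀ = ((# 2 :* # 0) :+ (a :- b)) :* (((# 2 :* # 0) :+ # 1) :+ (a :- b))
              r  = (:- # 1) :* (# 1 :+ a)
          in ((t₁₀ :+ X₁₁ :* w₁) :* (a :+ # 0)) :* Dn
             := ((((b :+ # 0) :* Dn
                   :+ (t₁₀ :- # 1) :* ((a :+ # 0) :* Dn))
                   :+ (X₁₁ :- r) :* ((w₁ :* Dn) :* (a :+ # 0)))
                   :+ ((w₁ :* Dn) :- (w₀ :* E₀)) :* (r :* (a :+ # 0)))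
                   :+ (w₀ :- # 1) :* ((r :* (a :+ # 0)) :* E₀))
          refl a b (term 1 0) (lead 1 1) (weight 0) (weight 1))
        (trans (x+[u−v]*y≈x _ weight-zero)
        (trans (x+[u−v]*y≈x _ (weight-suc-cleared 0 h₂))
        (trans (x+[u−v]*y≈x _ (*-cong (poch-1 _) (poch-1 _)))
               (x+[u−v]*y≈x _ (term-zero 1)))))

    series-closed-form-suc-suc : ∀ n → NotNegIntBelow (suc (suc n)) q₂ →
      series n * poch a n ≈ poch b n → series (suc n) * poch a (suc n) ≈ poch b (suc n) →
      series (suc (suc n)) * poch a (suc (suc n)) ≈ poch b (suc (suc n))
    series-closed-form-suc-suc n h₂ IH₀ IH₁ = begin
      series n₂ * ((poch a n * (a + ι n)) * (a + ι (suc n)))      ≈⟨ *-cong refl (*-cong refl (+-cong refl (ι-+ 1 n))) ⟩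
      series n₂ * ((poch a n * (a + ι n)) * (a + (ι 1 + ι n)))    ≈⟨ *-cancelʳ c≉0 (cleared IH₀ IH₁) ⟩
      (poch b n * (b + ι n)) * (b + (ι 1 + ι n))                  ≈⟨ *-cong refl (+-cong refl (sym (ι-+ 1 n))) ⟩
      poch b n₂                                                   ∎
      where
      n₂ : ℕ
      n₂ = suc (suc n)
      c : Carrier
      c = ((ι n + a) − b) + ι 2
      c≉0 : c ≉ 0#
      c≉0 = ≉0-resp (trans (+-cong refl (ι-+ 1 n)) (solve 3 (λ ν a b → ((# 1 :+ a) :- b) :+ (# 1 :+ ν) := ((ν :+ a) :- b) :+ # 2) refl (ι n) a b))
                    (h₂ (suc n) ℕP.≤-refl)
      cleared : series n * poch a n ≈ poch b n → series (suc n) * poch a (suc n) ≈ poch b (suc n) →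
        (series n₂ * ((poch a n * (a + ι n)) * (a + (ι 1 + ι n)))) * c ≈ ((poch b n * (b + ι n)) * (b + (ι 1 + ι n))) * c
      cleared ih₀ ih₁ =
        trans (solve 8 (λ ν a b Q₀ Q₁ Q₂ A B →
          let P₀ = (ν :+ # 1) :* (ν :+ b)
              P₁ = :- (((a :+ ν) :* (ν :+ # 1)) :+ ((((ν :+ a) :- b) :+ # 2) :* ((ν :+ b) :+ # 1)))
              P₂ = ((ν :+ a) :+ # 1) :* (((ν :+ a) :- b) :+ # 2)
              c  = ((ν :+ a) :- b) :+ # 2
          in (Q₂ :* ((A :* (a :+ ν)) :* (a :+ (# 1 :+ ν)))) :* c
             := ((((B :* (b :+ ν)) :* (b :+ (# 1 :+ ν))) :* c
                  :+ (((P₀ :* Q₀) :+ (P₁ :* Q₁)) :+ (P₂ :* Q₂)) :* (A :* (a :+ ν)))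
                  :+ ((Q₀ :* A) :- B) :* (:- (P₀ :* (a :+ ν))))
                  :+ ((Q₁ :* (A :* (a :+ ν))) :- (B :* (b :+ ν))) :* (:- P₁))
          refl (ι n) a b (series n) (series (suc n)) (series n₂) (poch a n) (poch b n))
        (trans (x+[u−v]*y≈x _ ih₁)
        (trans (x+[u−v]*y≈x _ ih₀)
               (x+y*z≈x _ (Recurrence.recurrence n h₂))))

    series-closed-form : ∀ n → NotNegIntBelow n q₂ → series n * poch a n ≈ poch b n
    series-closed-form zero          _  = trans (*-identityʳ _) (trans (term-zero 0) (sym 1≈ι1))
    series-closed-form (suc zero)    h₂ = series-closed-form-1 h₂
    series-closed-form (suc (suc n)) h₂ = series-closed-form-suc-suc n h₂
      (series-closed-form n (NotNegIntBelow-≤ (ℕP.m≤n⇒m≤1+n (ℕP.n≤1+n n)) h₂))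
      (series-closed-form (suc n) (NotNegIntBelow-≤ (ℕP.n≤1+n (suc n)) h₂))

module NestedSummation {c′ ℓ : Level} (K : CharZeroField c′ ℓ) (a b c d : CharZeroField.Carrier K) where
  open FieldArithmetic K
  open Pochhammer K
  open FiniteSums K
  open PfaffSaalschütz K
  open FourF3Summation K a b

  e f g : Carrier
  e = ((ι 1 + a) − c) − d
  f = (ι 1 + a) − c
  g = (ι 1 + a) − d

  r : ℕ → Carrier
  r k = ((c + d) − a) − ι k

  module _ (n : ℕ) (a≉-ℕ : ∀ j → a + ι j ≉ 0#) (hf : NotNegIntBelow n f) (hg : NotNegIntBelow n g)
           (hq₂ : NotNegIntBelow n q₂) (hr : ∀ k → k ≤ n → NotNegIntBelow k (r k)) where

    outerNum outerDen : ℕ → Carrier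
    outerNum k = poch (- ι n) k * poch (ι n + a) k * poch e k
    outerDen k = fact k * poch f k * poch g k

    innerNum innerDen : ℕ → ℕ → Carrier
    innerNum k m = poch (- ι k) m * pochs (p₁ ∷ p₂ ∷ c ∷ d ∷ []) m
    innerDen k m = fact m * pochs (q₁ ∷ q₂ ∷ q₃ ∷ r k ∷ []) m

    F : ℕ → ℕ → Carrier
    F k m = (outerNum k / outerDen k) * ((innerNum k m / innerDen k m) * pow 1# m)

    κ : Carrier
    κ = (poch c n * poch d n) / (poch f n * poch g n)

    fg-≉0 : ∀ k → k ≤ n → poch f k * poch g k ≉ 0#
    fg-≉0 k k≤n = *-≉0 (poch-≉0 k (NotNegIntBelow-≤ k≤n hf)) (poch-≉0 k (NotNegIntBelow-≤ k≤n hg))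

    -- The column m of the triangular double sum, with N = n - m.
    module Column (m N : ℕ) (m+N≡n : m ℕ.+ N ≡.≡ n) where
      A C D H s : Carrier
      A = (ι n + a) + ι m
      C = f + ι m
      D = g + ι m
      H = weight m * (poch c m * poch d m)
      s = lead n m / (poch f m * poch g m)

      t : ℕ → Carrier
      t = saalTerm N A e C D

      m≤n : m ≤ n
      m≤n = ≡.subst (m ≤_) m+N≡n (ℕP.m≤m+n m N)

      ιn≈ : ι n ≈ ι m + ι N
      ιn≈ = trans (reflexive (≡.cong ι (≡.sym m+N≡n))) (ι-+ m N)

      A≈ : A ≈ ((ι m + ι N) + a) + ι m
      A≈ = +-cong (+-cong ιn≈ refl) refl

      poch-split : ∀ x → poch x n ≈ poch x m * poch (x + ι m) N
      poch-split x = trans (reflexive (≡.cong (poch x) (≡.sym m+N≡n))) (poch-+ x m N)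

      shift : ∀ {x} → NotNegIntBelow n x → NotNegIntBelow N (x + ι m)
      shift h = NotNegIntBelow-shift m N (≡.subst (λ k → NotNegIntBelow k _) (≡.sym m+N≡n) h)

      saalschütz-column : sumTo N t * (poch C N * (sign N * poch D N)) ≈ (sign N * poch (c + ι m) N) * poch (d + ι m) N
      saalschütz-column = begin
        sumTo N t * (poch C N * (sign N * poch D N))   ≈⟨ *-cong refl (*-cong refl (sym (poch-reflect N C−A−e+D+N≈1))) ⟩
        sumTo N t * (poch C N * poch ((C − A) − e) N)  ≈⟨ pfaff-saalschütz N A e C D balanced (shift hf) (shift hg) ⟩
        poch (C − A) N * poch (C − e) N                ≈⟨ *-cong (poch-reflect N C−A+c+N≈1) (poch-cong N C−e≈) ⟩
        (sign N * poch (c + ι m) N) * poch (d + ι m) N ∎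
        where
        balanced : D + ι N ≈ ((ι 1 + A) + e) − C
        balanced = sym (trans (+-cong (+-cong (+-cong refl A≈) refl) refl)
          (solve 5 (λ a c d m N → ((# 1 :+ (((m :+ N) :+ a) :+ m)) :+ (((# 1 :+ a) :- c) :- d)) :- (((# 1 :+ a) :- c) :+ m)
                                  := (((# 1 :+ a) :- d) :+ m) :+ N) refl a c d (ι m) (ι N)))
        C−A−e+D+N≈1 : (((C − A) − e) + D) + ι N ≈ ι 1
        C−A−e+D+N≈1 = trans (+-cong (+-cong (+-cong (+-cong refl (-‿cong A≈)) refl) refl) refl)
          (solve 5 (λ a c d m N → ((((((# 1 :+ a) :- c) :+ m) :- (((m :+ N) :+ a) :+ m)) :- (((# 1 :+ a) :- c) :- d))
                                     :+ (((# 1 :+ a) :- d) :+ m)) :+ N := # 1) refl a c d (ι m) (ι N))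
        C−A+c+N≈1 : ((C − A) + (c + ι m)) + ι N ≈ ι 1
        C−A+c+N≈1 = trans (+-cong (+-cong (+-cong refl (-‿cong A≈)) refl) refl)
          (solve 5 (λ a c d m N → (((((# 1 :+ a) :- c) :+ m) :- (((m :+ N) :+ a) :+ m)) :+ (c :+ m)) :+ N := # 1) refl a c d (ι m) (ι N))
        C−e≈ : C − e ≈ d + ι m
        C−e≈ = solve 4 (λ a c d m → (((# 1 :+ a) :- c) :+ m) :- (((# 1 :+ a) :- c) :- d) := d :+ m) refl a c d (ι m)

      module Entry (j : ℕ) (j≤N : j ≤ N) where
        k : ℕ
        k = m ℕ.+ j
        k≤n : k ≤ n
        k≤n = ≡.subst (k ≤_) m+N≡n (ℕP.+-monoʳ-≤ m j≤N)
        nm Nj am Aj ej ejm σ u P cm dm W Fm Gm Cj Dj SN SD : Carrier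
        nm = poch (- ι n) m
        Nj = poch (- ι N) j
        am = poch (ι n + a) m
        Aj = poch A j
        ej = poch e j
        ejm = poch (e + ι j) m
        σ = sign m
        u = poch (ι 1 + ι j) m
        P = poch p₁ m * poch p₂ m
        cm = poch c m
        dm = poch d m
        W = fact m * ((poch q₁ m * poch q₂ m) * poch q₃ m)
        Fm = poch f m
        Gm = poch g m
        Cj = poch C j
        Dj = poch D j
        SN = (Nj * Aj) * ej
        SD = (fact j * Cj) * Dj
        outerDen≉0 : outerDen k ≉ 0#
        outerDen≉0 = *-≉0 (*-≉0 (fact-≉0 k) (poch-≉0 k (NotNegIntBelow-≤ k≤n hf))) (poch-≉0 k (NotNegIntBelow-≤ k≤n hg))
        innerDen≉0 : innerDen k m ≉ 0#
        innerDen≉0 = *-≉0 (fact-≉0 m) (*-≉0 (poch-≉0 m (λ i _ → q₁+ι≉0 a≉-ℕ i)) (*-≉0 (poch-≉0 m (NotNegIntBelow-≤ m≤n hq₂))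
                       (*-≉0 (poch-≉0 m (λ i _ → q₃+ι≉0 a≉-ℕ i))
                       (*-≉0 (poch-≉0 m (NotNegIntBelow-≤ (ℕP.m≤m+n m j) (hr k k≤n))) 1≉0))))
        weightDen≉0 : W ≉ 0#
        weightDen≉0 = weightDen-≉0 a≉-ℕ m (NotNegIntBelow-≤ m≤n hq₂)
        fgm≉0 : Fm * Gm ≉ 0#
        fgm≉0 = fg-≉0 m m≤n
        saalDen≉0 : SD ≉ 0#
        saalDen≉0 = saalDen-≉0 j (NotNegIntBelow-≤ j≤N (shift hf)) (NotNegIntBelow-≤ j≤N (shift hg))
        outerNum≈ : outerNum k ≈ ((nm * Nj) * (am * Aj)) * (ej * ejm)
        outerNum≈ = *-cong (*-cong (trans (poch-+ (- ι n) m j) (*-cong refl (poch-cong j −n+m≈−N))) (poch-+ (ι n + a) m j))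
                           (trans (reflexive (≡.cong (poch e) (ℕP.+-comm m j))) (poch-+ e j m))
          where
          −n+m≈−N : (- ι n) + ι m ≈ - ι N
          −n+m≈−N = trans (+-cong (-‿cong ιn≈) refl) (solve 2 (λ m N → :- (m :+ N) :+ m := :- N) refl (ι m) (ι N))
        fact≈ : fact k ≈ fact j * u
        fact≈ = trans (*-cong refl (trans (reflexive (≡.cong (poch (ι 1)) (ℕP.+-comm m j))) (poch-+ (ι 1) j m))) (sym (*-assoc _ _ _))
        innerNum≈ : innerNum k m ≈ (σ * u) * (poch p₁ m * (poch p₂ m * (cm * (dm * 1#))))
        innerNum≈ = *-cong (poch-reflect m (trans (+-cong (+-cong (-‿cong (ι-+ m j)) refl) refl)
                             (solve 2 (λ m j → ((:- (m :+ j)) :+ (# 1 :+ j)) :+ m := # 1) refl (ι m) (ι j)))) refl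
        outerDen≈ : outerDen k ≈ ((fact j * u) * (Fm * Cj)) * (Gm * Dj)
        outerDen≈ = *-cong (*-cong fact≈ (poch-+ f m j)) (poch-+ g m j)
        innerDen≈ : innerDen k m ≈ fact m * (poch q₁ m * (poch q₂ m * (poch q₃ m * ((σ * ejm) * 1#))))
        innerDen≈ = *-cong refl (*-cong refl (*-cong refl (*-cong refl (*-cong (poch-reflect m r+e+j+m≈1) refl))))
          where
          r+e+j+m≈1 : (r k + (e + ι j)) + ι m ≈ ι 1
          r+e+j+m≈1 = trans (+-cong (+-cong (+-cong refl (-‿cong (ι-+ m j))) refl) refl)
            (solve 5 (λ a c d m j → ((((c :+ d) :- a) :- (m :+ j)) :+ ((((# 1 :+ a) :- c) :- d) :+ j)) :+ m := # 1) refl a c d (ι m) (ι j))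
        cross : (outerNum k * innerNum k m) * ((W * (Fm * Gm)) * SD) ≈ (((P * (cm * dm)) * lead n m) * SN) * (outerDen k * innerDen k m)
        cross = begin
          (outerNum k * innerNum k m) * ((W * (Fm * Gm)) * SD)
            ≈⟨ *-cong (*-cong outerNum≈ innerNum≈) refl ⟩
          ((((nm * Nj) * (am * Aj)) * (ej * ejm)) * ((σ * u) * (poch p₁ m * (poch p₂ m * (cm * (dm * 1#)))))) * ((W * (Fm * Gm)) * SD)
            ≈⟨ solve 22 (λ nm Nj am Aj ej ejm σ u p₁ p₂ cm dm one fm q₁ q₂ q₃ Fm Gm fj Cj Dj →
                  ((((nm :* Nj) :* (am :* Aj)) :* (ej :* ejm)) :* ((σ :* u) :* (p₁ :* (p₂ :* (cm :* (dm :* one))))))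
                    :* (((fm :* ((q₁ :* q₂) :* q₃)) :* (Fm :* Gm)) :* ((fj :* Cj) :* Dj))
                  := ((((p₁ :* p₂) :* (cm :* dm)) :* (nm :* am)) :* ((Nj :* Aj) :* ej))
                    :* ((((fj :* u) :* (Fm :* Cj)) :* (Gm :* Dj)) :* (fm :* (q₁ :* (q₂ :* (q₃ :* ((σ :* ejm) :* one)))))))
                 refl nm Nj am Aj ej ejm σ u (poch p₁ m) (poch p₂ m) cm dm 1# (fact m) (poch q₁ m) (poch q₂ m) (poch q₃ m) Fm Gm (fact j) Cj Dj ⟩
          (((P * (cm * dm)) * lead n m) * SN)
            * ((((fact j * u) * (Fm * Cj)) * (Gm * Dj)) * (fact m * (poch q₁ m * (poch q₂ m * (poch q₃ m * ((σ * ejm) * 1#))))))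
            ≈⟨ *-cong refl (sym (*-cong outerDen≈ innerDen≈)) ⟩
          (((P * (cm * dm)) * lead n m) * SN) * (outerDen k * innerDen k m) ∎

        reindex : F k m ≈ (H * s) * t j
        reindex = begin
          F k m
            ≈⟨ *-cong refl (trans (*-cong refl (pow-1# m)) (*-identityʳ _)) ⟩
          (outerNum k / outerDen k) * (innerNum k m / innerDen k m)
            ≈⟨ /-*-/ outerDen≉0 innerDen≉0 ⟩
          (outerNum k * innerNum k m) / (outerDen k * innerDen k m)
            ≈⟨ /-cross (*-≉0 outerDen≉0 innerDen≉0) (*-≉0 (*-≉0 weightDen≉0 fgm≉0) saalDen≉0) cross ⟩
          (((P * (cm * dm)) * lead n m) * SN) / ((W * (Fm * Gm)) * SD)
            ≈⟨ sym (/-*-/ (*-≉0 weightDen≉0 fgm≉0) saalDen≉0) ⟩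
          (((P * (cm * dm)) * lead n m) / (W * (Fm * Gm))) * t j
            ≈⟨ *-cong (sym (trans (*-cong (/-*ʳ P W (cm * dm)) refl) (/-*-/ weightDen≉0 fgm≉0))) refl ⟩
          (H * s) * t j ∎

      column-sum : sumTo N (λ j → F (m ℕ.+ j) m) ≈ κ * term n m
      column-sum = begin
        sumTo N (λ j → F (m ℕ.+ j) m)  ≈⟨ sumTo-cong N Entry.reindex ⟩
        sumTo N (λ j → (H * s) * t j)   ≈⟨ sym (*-distribˡ-sumTo N (H * s) t) ⟩
        (H * s) * sumTo N t             ≈⟨ *-cancelʳ (*-≉0 (fg-≉0 n ℕP.≤-refl) (sign-≉0 N)) cleared ⟩
        κ * term n m                    ∎
        where
        cleared : ((H * s) * sumTo N t) * ((poch f n * poch g n) * sign N) ≈ (κ * term n m) * ((poch f n * poch g n) * sign N)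
        cleared = begin
          ((H * s) * sumTo N t) * ((poch f n * poch g n) * sign N)
            ≈⟨ *-cong refl (*-cong (*-cong (poch-split f) (poch-split g)) refl) ⟩
          ((H * s) * sumTo N t) * (((poch f m * poch C N) * (poch g m * poch D N)) * sign N)
            ≈⟨ solve 8 (λ H s S Fm CN Gm DN σ → ((H :* s) :* S) :* (((Fm :* CN) :* (Gm :* DN)) :* σ)
                                               := (H :* (s :* (Fm :* Gm))) :* (S :* (CN :* (σ :* DN))))
                 refl H s (sumTo N t) (poch f m) (poch C N) (poch g m) (poch D N) (sign N) ⟩
          (H * (s * (poch f m * poch g m))) * (sumTo N t * (poch C N * (sign N * poch D N)))
            ≈⟨ *-cong (*-cong refl (/-*-cancel (lead n m) (fg-≉0 m m≤n))) saalschütz-column ⟩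
          ((weight m * (poch c m * poch d m)) * lead n m) * ((sign N * poch (c + ι m) N) * poch (d + ι m) N)
            ≈⟨ solve 7 (λ w cm dm X σ cN dN → ((w :* (cm :* dm)) :* X) :* ((σ :* cN) :* dN) := ((cm :* cN) :* (dm :* dN)) :* ((X :* w) :* σ))
                 refl (weight m) (poch c m) (poch d m) (lead n m) (sign N) (poch (c + ι m) N) (poch (d + ι m) N) ⟩
          ((poch c m * poch (c + ι m) N) * (poch d m * poch (d + ι m) N)) * (term n m * sign N)
            ≈⟨ *-cong (sym (trans (/-*-cancel _ (fg-≉0 n ℕP.≤-refl)) (*-cong (poch-split c) (poch-split d)))) refl ⟩
          (κ * (poch f n * poch g n)) * (term n m * sign N)
            ≈⟨ solve 4 (λ k FG t σ → (k :* FG) :* (t :* σ) := (k :* t) :* (FG :* σ)) refl κ (poch f n * poch g n) (term n m) (sign N) ⟩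
          (κ * term n m) * ((poch f n * poch g n) * sign N) ∎

    nested-sum : sumTo n (λ k → (outerNum k / outerDen k) * termHyp k (p₁ ∷ p₂ ∷ c ∷ d ∷ []) (q₁ ∷ q₂ ∷ q₃ ∷ r k ∷ []) 1#)
                 ≈ (poch b n * poch c n * poch d n) / (poch a n * poch f n * poch g n)
    nested-sum = begin
      sumTo n (λ k → (outerNum k / outerDen k) * sumTo k (λ m → (innerNum k m / innerDen k m) * pow 1# m))
        ≈⟨ sumTo-cong n (λ k _ → *-distribˡ-sumTo k _ _) ⟩
      sumTo n (λ k → sumTo k (F k))
        ≈⟨ sumTo-triangle n F ⟩
      sumTo n (λ m → sumTo (n ∸ m) (λ j → F (m ℕ.+ j) m))
        ≈⟨ sumTo-cong n (λ m m≤n → Column.column-sum m (n ∸ m) (ℕP.m+[n∸m]≡n m≤n)) ⟩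
      sumTo n (λ m → κ * term n m)
        ≈⟨ sym (*-distribˡ-sumTo n κ (term n)) ⟩
      κ * series n
        ≈⟨ x*y≈z⇒x≈z/y (*-≉0 (*-≉0 (poch-≉0 n (λ j _ → a≉-ℕ j)) (poch-≉0 n hf)) (poch-≉0 n hg)) cleared ⟩
      (poch b n * poch c n * poch d n) / (poch a n * poch f n * poch g n) ∎
      where
      cleared : (κ * series n) * (poch a n * poch f n * poch g n) ≈ poch b n * poch c n * poch d n
      cleared = begin
        (κ * series n) * (poch a n * poch f n * poch g n)
          ≈⟨ solve 5 (λ k Q A F G → (k :* Q) :* ((A :* F) :* G) := (k :* (F :* G)) :* (Q :* A)) refl κ (series n) (poch a n) (poch f n) (poch g n) ⟩
        (κ * (poch f n * poch g n)) * (series n * poch a n)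
          ≈⟨ *-cong (/-*-cancel _ (fg-≉0 n ℕP.≤-refl)) (series-closed-form a≉-ℕ n hq₂) ⟩
        (poch c n * poch d n) * poch b n
          ≈⟨ solve 3 (λ x y z → (x :* y) :* z := (z :* x) :* y) refl (poch c n) (poch d n) (poch b n) ⟩
        poch b n * poch c n * poch d n ∎

mainTheorem8 : ∀ {c′ ℓ : Level} (K : CharZeroField c′ ℓ) →
    let open CharZeroField K in
    let open FieldOps K in
    (a b c d : Carrier) →
    (∀ j → ¬ (a + ι j ≈ 0#)) →
    (n : ℕ) →
    NotNegIntBelow n ((ι 1 + a) − c) →
    NotNegIntBelow n ((ι 1 + a) − d) →
    (∀ k → k ≤ n →
      NotNegIntBelow k (a * half) ×
      NotNegIntBelow k ((ι 1 + a) − b) ×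
      NotNegIntBelow k ((ι 1 + a) * half) ×
      NotNegIntBelow k (((c + d) − a) − ι k)) →
    sumTo n (λ k →
      ((poch (- ι n) k * poch (ι n + a) k * poch (((ι 1 + a) − c) − d) k)
        / (fact k * poch ((ι 1 + a) − c) k * poch ((ι 1 + a) − d) k))
      * termHyp k
          ((a − b) * half ∷ ((ι 1 + a) − b) * half ∷ c ∷ d ∷ [])
          (a * half ∷ (ι 1 + a) − b ∷ (ι 1 + a) * half ∷ ((c + d) − a) − ι k ∷ [])
          1#)
    ≈ ((poch b n * poch c n * poch d n)
        / (poch a n * poch ((ι 1 + a) − c) n * poch ((ι 1 + a) − d) n))
mainTheorem8 K a b c d a≉-ℕ n hf hg hk =
  NestedSummation.nested-sum K a b c d n a≉-ℕ hf hg
    (proj₁ (proj₂ (hk n ℕP.≤-refl)))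
    (λ k k≤n → proj₂ (proj₂ (proj₂ (hk k k≤n))))
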